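{- Let $\mathbb{K}$ be a field, $M\geqslant 2$ an integer, and let $x_0,x_1,\ldots,x_M$ be points of $\mathrm{PG}_M(\mathbb{K})$ in general position. Put $\Sigma_i=x_0\oplus x_1\oplus\cdots\oplus x_i$ and $\pi_i=x_1\oplus\cdots\oplus x_i$ for $i=1,\ldots,M$. For $i=3,\ldots,M$ let $y_i$ be a point of the line $x_{i-1}\oplus x_i$ distinct from $x_{i-1}$ and $x_i$. Let $L$ be a finite set of lines of the plane $\Sigma_2$, none equal to $\pi_2$, which meet $\pi_2$ in pairwise distinct points of $\pi_2\setminus\{x_2\}$; label them $\ell_{(1)},\ldots,\ell_{(|L|)}$ and put $p_{(i)}=\ell_{(i)}\cap\pi_2$. For every ordered subset $J$ of $\{1,\ldots,|L|\}$ with $2\leqslant |J|\leqslant M-1$, writing $J=(\ldots,b,a)$ (so $b,a$ are its last two entries), define recursively $$\ell_J=(x_{|J|+1}\oplus \ell_{J\setminus\{a\}})\cap(y_{|J|+1}\oplus \ell_{J\setminus\{b\}}),\qquad p_J=(x_{|J|+1}\oplus p_{J\setminus\{a\}})\cap(y_{|J|+1}\oplus p_{J\setminus\{b\}}).$$ Then for every ordered subset $J$ with $1\leqslant |J|\leqslant M-1$, $\ell_J$ is a well-defined line and $p_J$ is a well-defined point; $\ell_J\neq\ell_{J'}$ and $p_J\neq p_{J'}$ whenever $J\neq J'$; and the line $\ell_J$ intersects $\pi_{|J|+1}$ in the point $p_J$.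
   Context: For non-intersecting subspaces $x,y$ of a projective space, $x\oplus y$ denotes the subspace they span. An ordered subset of $\{1,\ldots,|L|\}$ is a finite sequence $J=(a_1,\ldots,a_j)$ of pairwise distinct elements of $\{1,\ldots,|L|\}$, with $|J|=j$; for an entry $a$ of $J$, $J\setminus\{a\}$ denotes the ordered subset obtained from $J$ by deleting $a$ and keeping the order of the remaining entries. For $|J|=1$, $J=(i)$, the line $\ell_J$ and point $p_J$ are the given $\ell_{(i)}$ and $p_{(i)}$. -}

module Defs where

open import Level using (Level; _⊔_) renaming (suc to lsuc)
open import Algebra.Bundles using (CommutativeRing)
open import Data.Nat using (ℕ; zero; suc)
open import Data.Fin using (Fin)
open import Data.Vec using (Vec; []; _∷_)
open import Data.Vec.Relation.Unary.All using (All)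
open import Data.List using (List; map; upTo)
import Data.Vec as V
open import Data.Product using (Σ; ∃; _×_; _,_)
open import Relation.Nullary using (¬_)

record Field (c ℓ : Level) : Set (lsuc (c ⊔ ℓ)) where
  field
    commutativeRing : CommutativeRing c ℓ
  open CommutativeRing commutativeRing public
  field
    0≉1 : ¬ (0# ≈ 1#)
    inverse : ∀ x → ¬ (x ≈ 0#) → ∃ λ y → x * y ≈ 1#

-- Projective geometry of PG_M(K), modelled on the vector space K^(M+1).
-- Subspaces are modelled as predicates on vectors (the underlying linear subspaces).
module PG {c ℓ : Level} (F : Field c ℓ) (M : ℕ) where
  open Field F

  Vect : Set c
  Vect = Fin (suc M) → Carrier

  _≈ᵥ_ : Vect → Vect → Set ℓ
  u ≈ᵥ v = ∀ i → u i ≈ v i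

  0ᵥ : Vect
  0ᵥ _ = 0#

  _+ᵥ_ : Vect → Vect → Vect
  (u +ᵥ v) i = u i + v i

  _·_ : Carrier → Vect → Vect
  (a · v) i = a * v i

  lincomb : ∀ {m} → Vec Carrier m → Vec Vect m → Vect
  lincomb [] [] = 0ᵥ
  lincomb (a ∷ as) (v ∷ vs) = (a · v) +ᵥ lincomb as vs

  LinIndep : ∀ {m} → Vec Vect m → Set (c ⊔ ℓ)
  LinIndep {m} vs = ∀ (cs : Vec Carrier m) → lincomb cs vs ≈ᵥ 0ᵥ → All (λ a → a ≈ 0#) cs

  Subspace : Set (lsuc (c ⊔ ℓ))
  Subspace = Vect → Set (c ⊔ ℓ)

  _≐_ : Subspace → Subspace → Set (c ⊔ ℓ)
  S ≐ T = ∀ v → (S v → T v) × (T v → S v)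

  _⊆_ : Subspace → Subspace → Set (c ⊔ ℓ)
  S ⊆ T = ∀ v → S v → T v

  Span : ∀ {m} → Vec Vect m → Subspace
  Span {m} vs v = ∃ λ (cs : Vec Carrier m) → v ≈ᵥ lincomb cs vs

  ⟨_⟩ : Vect → Subspace
  ⟨ u ⟩ = Span (u ∷ [])

  _⊕_ : Subspace → Subspace → Subspace
  (S ⊕ T) v = ∃ λ s → ∃ λ t → S s × T t × v ≈ᵥ (s +ᵥ t)

  _∩_ : Subspace → Subspace → Subspace
  (S ∩ T) v = S v × T v

  IsPoint : Subspace → Set (c ⊔ ℓ)
  IsPoint S = ∃ λ u → ¬ (u ≈ᵥ 0ᵥ) × (S ≐ ⟨ u ⟩)

  IsLine : Subspace → Set (c ⊔ ℓ)
  IsLine S = ∃ λ u → ∃ λ w → LinIndep (u ∷ w ∷ []) × (S ≐ Span (u ∷ w ∷ []))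

  range : (ℕ → Vect) → ℕ → (k : ℕ) → Vec Vect k
  range x a zero = []
  range x a (suc k) = x a ∷ range x (suc a) k

  Σsp : (ℕ → Vect) → ℕ → Subspace
  Σsp x i = Span (range x 0 (suc i))

  πsp : (ℕ → Vect) → ℕ → Subspace
  πsp x i = Span (range x 1 i)

  -- An ordered subset J = (a_1, ..., a_j) is stored REVERSED as the vector
  -- a_j ∷ a_{j-1} ∷ ... ∷ a_1, so that J = (…, b, a) is  a ∷ b ∷ rest,
  -- J∖{a} = b ∷ rest  and  J∖{b} = a ∷ rest  (order of remaining entries kept).
  -- For |J| = suc (suc k) we have |J| + 1 = k + 3.
  module Construction (x y : ℕ → Vect) {n : ℕ} (lines : Fin n → Subspace) where

    ℓJ : ∀ {k} → Vec (Fin n) (suc k) → Subspace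
    ℓJ (i ∷ []) = lines i
    ℓJ {suc k} (a ∷ b ∷ rest) =
      (⟨ x (3 Data.Nat.+ k) ⟩ ⊕ ℓJ (b ∷ rest)) ∩ (⟨ y (3 Data.Nat.+ k) ⟩ ⊕ ℓJ (a ∷ rest))

    pJ : ∀ {k} → Vec (Fin n) (suc k) → Subspace
    pJ (i ∷ []) = lines i ∩ πsp x 2
    pJ {suc k} (a ∷ b ∷ rest) =
      (⟨ x (3 Data.Nat.+ k) ⟩ ⊕ pJ (b ∷ rest)) ∩ (⟨ y (3 Data.Nat.+ k) ⟩ ⊕ pJ (a ∷ rest))

module Submission where

-- We fix the basis x_0, ..., x_M and describe vectors by coordinate functions
-- f : ℕ → K (module Coordinates).  Each given line ℓ_(u) has a basis in normal
-- form P_u = x₁ + t_u x₂, Q_u = x₀ + r_u x₂ with ℓ_(u) ∩ π₂ = ⟨P_u⟩ (NormalForm).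
-- The heart of the proof is one computation (Meet): if two families of
-- generators A, B differ only in the coordinate at x_j, vanish at x_{j+1}, and
-- y = α x_j + κα x_{j+1} with α ≠ 0, then (x_{j+1} ⊕ ⟪A⟫) ∩ (y ⊕ ⟪B⟫) is spanned
-- by the family A + κ (A_j − B_j) x_{j+1}.  Iterating it (Generators) gives
-- explicit generators P_J, Q_J of ℓ_J and P_J of p_J.  Their coordinates at
-- x_0, x_1 never change, which makes ℓ_J a line, p_J a point and ℓ_J ∩ π_{|J|+1}
-- = p_J; their top coordinate at x_{|J|+1} is κ (top(J∖a) − top(J∖b)), which
-- separates distinct J (Distinct).

open import Defs
open import Level using (_⊔_)
open import Algebra.Bundles using (CommutativeRing; RawRing)
import Algebra.Properties.AbelianGroup as AbelianGroupProperties
open import Algebra.Solver.Ring.AlmostCommutativeRing as ACR using (_-Raw-AlmostCommutative⟶_)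
open import Data.Empty using (⊥; ⊥-elim)
open import Data.Fin using (Fin)
import Data.Fin as Fin
open import Data.List.Relation.Unary.All using (_∷_)
open import Data.List.Relation.Unary.AllPairs using (_∷_)
open import Data.List.Relation.Unary.Unique.Propositional using (Unique)
open import Data.Maybe using (Maybe; just; nothing)
open import Data.Nat as ℕ using (ℕ; zero; suc; _≤_; _<_; z≤n; s≤s; _∸_)
import Data.Nat.Properties as ℕₚ
open import Data.Product using (∃; ∃₂; _×_; _,_; proj₁; proj₂)
import Data.Product.Properties as ×ₚ
open import Data.Vec using (Vec; []; _∷_; lookup; zipWith; replicate; tabulate; toList)
import Data.Vec as Vec
import Data.Vec.Properties as Vecₚ
open import Data.Vec.Relation.Unary.All using (All; []; _∷_)
import Data.Vec.Relation.Unary.All.Properties as Allₚ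
open import Relation.Binary.Definitions using (tri<; tri≈; tri>)
open import Relation.Binary.PropositionalEquality as P using (_≡_; _≢_)
open import Relation.Nullary using (¬_; yes; no)

-- The library's ring solver needs a coefficient ring mapping into the
-- target ring.  Over an arbitrary commutative ring the natural choice is
-- the integers, which we represent as normalised differences (p , q) of
-- naturals (one of p, q is zero), so that equal integers are
-- definitionally equal and the solver's normal forms can be compared.
module IntegerCoefficientSolver {c ℓ} (CR : CommutativeRing c ℓ) where
  open CommutativeRing CR
  open import Algebra.Definitions.RawMonoid +-rawMonoid using () renaming (_×_ to _×ₙ_)
  open import Algebra.Properties.Semiring.Mult semiring using (×1-homo-*)
  open import Algebra.Properties.Monoid.Mult +-monoid using (×-homo-+)
  open import Algebra.Properties.Ring ring using (-‿distribˡ-*; -‿distribʳ-*; -0#≈0#)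
  open AbelianGroupProperties +-abelianGroup
    using (⁻¹-∙-comm; ⁻¹-anti-homo‿-; ⁻¹-involutive)
  open import Relation.Binary.Reasoning.Setoid setoid

  ℤ₂ : Set
  ℤ₂ = ℕ × ℕ

  normalise : ℕ → ℕ → ℤ₂
  normalise p q = (p ℕ.∸ q , q ℕ.∸ p)

  ℤ₂-rawRing : RawRing _ _
  ℤ₂-rawRing = record
    { Carrier = ℤ₂ ; _≈_ = _≡_
    ; _+_ = λ { (a , b) (c , d) → normalise (a ℕ.+ c) (b ℕ.+ d) }
    ; _*_ = λ { (a , b) (c , d) → normalise (a ℕ.* c ℕ.+ b ℕ.* d) (a ℕ.* d ℕ.+ b ℕ.* c) }
    ; -_ = λ { (a , b) → (b , a) }
    ; 0# = (0 , 0) ; 1# = (1 , 0) }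

  ⟦_⟧₀ : ℤ₂ → Carrier
  ⟦ (p , q) ⟧₀ = p ×ₙ 1# - q ×ₙ 1#

  -- n · 1#, without a trailing + 0#
  lit : ℕ → Carrier
  lit zero = 0#
  lit (suc zero) = 1#
  lit (suc (suc n)) = 1# + lit (suc n)

  lit≈× : ∀ n → lit n ≈ n ×ₙ 1#
  lit≈× zero = refl
  lit≈× (suc zero) = sym (+-identityʳ 1#)
  lit≈× (suc (suc n)) = +-congˡ (lit≈× (suc n))

  -- the interpretation used by the solver; it sends 0, 1, -1 to 0#, 1#, - 1# on the nose
  ⟦_⟧ : ℤ₂ → Carrier
  ⟦ (p , zero) ⟧ = lit p
  ⟦ (zero , suc q) ⟧ = - lit (suc q)
  ⟦ (suc p , suc q) ⟧ = ⟦ (p , q) ⟧₀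

  diff-+ : ∀ a b c d → (a + c) - (b + d) ≈ (a - b) + (c - d)
  diff-+ a b c d = begin
    (a + c) + - (b + d)    ≈⟨ +-congˡ (sym (⁻¹-∙-comm b d)) ⟩
    (a + c) + (- b + - d)  ≈⟨ +-assoc a c _ ⟩
    a + (c + (- b + - d))  ≈⟨ +-congˡ (trans (sym (+-assoc c _ _)) (trans (+-congʳ (+-comm c _)) (+-assoc _ c _))) ⟩
    a + (- b + (c + - d))  ≈⟨ sym (+-assoc a _ _) ⟩
    (a - b) + (c - d)      ∎

  cancel-common : ∀ x a b → (x + a) - (x + b) ≈ a - b
  cancel-common x a b = begin
    (x + a) - (x + b)    ≈⟨ diff-+ x x a b ⟩
    (x - x) + (a - b)    ≈⟨ +-congʳ (-‿inverseʳ x) ⟩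
    0# + (a - b)         ≈⟨ +-identityˡ _ ⟩
    a - b                ∎

  diff-* : ∀ a b c d → (a * c + b * d) - (a * d + b * c) ≈ (a - b) * (c - d)
  diff-* a b c d = sym (begin
    (a - b) * (c - d)                              ≈⟨ distribʳ (c - d) a (- b) ⟩
    a * (c - d) + (- b) * (c - d)                  ≈⟨ +-cong (distribˡ a c (- d)) (distribˡ (- b) c (- d)) ⟩
    (a * c + a * - d) + (- b * c + - b * - d)      ≈⟨ +-cong (+-congˡ (sym (-‿distribʳ-* a d)))
                                                       (+-cong (sym (-‿distribˡ-* b c)) neg-neg) ⟩
    (a * c + - (a * d)) + (- (b * c) + b * d)      ≈⟨ +-congˡ (+-comm _ _) ⟩
    (a * c + - (a * d)) + (b * d + - (b * c))      ≈⟨ sym (diff-+ _ _ _ _) ⟩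
    (a * c + b * d) - (a * d + b * c)              ∎)
    where
    neg-neg : - b * - d ≈ b * d
    neg-neg = trans (sym (-‿distribˡ-* b (- d)))
                (trans (-‿cong (sym (-‿distribʳ-* b d))) (⁻¹-involutive (b * d)))

  ⟦⟧≈⟦⟧₀ : ∀ z → ⟦ z ⟧ ≈ ⟦ z ⟧₀
  ⟦⟧≈⟦⟧₀ (p , zero) = trans (lit≈× p) (sym (trans (+-congˡ -0#≈0#) (+-identityʳ _)))
  ⟦⟧≈⟦⟧₀ (zero , suc q) = trans (-‿cong (lit≈× (suc q))) (sym (+-identityˡ _))
  ⟦⟧≈⟦⟧₀ (suc p , suc q) = sym (cancel-common 1# _ _)

  normalise-sound : ∀ p q → ⟦ normalise p q ⟧ ≈ ⟦ (p , q) ⟧₀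
  normalise-sound p q = trans (⟦⟧≈⟦⟧₀ (normalise p q)) (go p q)
    where
    go : ∀ p q → ⟦ normalise p q ⟧₀ ≈ ⟦ (p , q) ⟧₀
    go zero zero = refl
    go zero (suc q) = refl
    go (suc p) zero = refl
    go (suc p) (suc q) = trans (go p q) (sym (cancel-common 1# _ _))

  morphism : ℤ₂-rawRing -Raw-AlmostCommutative⟶ ACR.fromCommutativeRing CR
  morphism = record
    { ⟦_⟧ = ⟦_⟧
    ; +-homo = λ { (a , b) (c , d) → via₂ _+_ +-cong (a , b) (c , d)
        (trans (normalise-sound (a ℕ.+ c) (b ℕ.+ d))
          (trans (−-cong (×-homo-+ 1# a c) (×-homo-+ 1# b d)) (diff-+ _ _ _ _))) }
    ; *-homo = λ { (a , b) (c , d) → via₂ _*_ *-cong (a , b) (c , d)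
        (trans (normalise-sound (a ℕ.* c ℕ.+ b ℕ.* d) (a ℕ.* d ℕ.+ b ℕ.* c))
          (trans (−-cong (×-sum a c b d) (×-sum a d b c)) (diff-* _ _ _ _))) }
    ; -‿homo = λ { (a , b) → trans (⟦⟧≈⟦⟧₀ (b , a))
        (trans (sym (⁻¹-anti-homo‿- _ _)) (-‿cong (sym (⟦⟧≈⟦⟧₀ (a , b))))) }
    ; 0-homo = refl
    ; 1-homo = refl
    }
    where
    −-cong : ∀ {a b c d} → a ≈ c → b ≈ d → a - b ≈ c - d
    −-cong p q = +-cong p (-‿cong q)
    ×-sum : ∀ a c b d → (a ℕ.* c ℕ.+ b ℕ.* d) ×ₙ 1# ≈ (a ×ₙ 1#) * (c ×ₙ 1#) + (b ×ₙ 1#) * (d ×ₙ 1#)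
    ×-sum a c b d = trans (×-homo-+ 1# (a ℕ.* c) (b ℕ.* d)) (+-cong (×1-homo-* a c) (×1-homo-* b d))
    via₂ : ∀ {w} (_∙_ : Carrier → Carrier → Carrier) → (∀ {a b c d} → a ≈ b → c ≈ d → (a ∙ c) ≈ (b ∙ d)) →
           ∀ p q → w ≈ (⟦ p ⟧₀ ∙ ⟦ q ⟧₀) → w ≈ (⟦ p ⟧ ∙ ⟦ q ⟧)
    via₂ _∙_ ∙-cong p q h = trans h (sym (∙-cong (⟦⟧≈⟦⟧₀ p) (⟦⟧≈⟦⟧₀ q)))

  decide : ∀ p q → Maybe (⟦ p ⟧ ≈ ⟦ q ⟧)
  decide p q with ×ₚ.≡-dec ℕ._≟_ ℕ._≟_ p q
  ... | yes P.refl = just refl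
  ... | no _ = nothing

  open import Algebra.Solver.Ring ℤ₂-rawRing (ACR.fromCommutativeRing CR) morphism decide public
    using (solve; _:=_; _:+_; _:*_; _:-_; :-_; con)


module FieldFacts {c ℓ} (F : Field c ℓ) where
  open Field F
  open IntegerCoefficientSolver commutativeRing using (solve; _:=_; _:+_; _:-_)
  open import Relation.Binary.Reasoning.Setoid setoid

  infix 30 _⁻¹⟨_⟩
  _⁻¹⟨_⟩ : (a : Carrier) → ¬ a ≈ 0# → Carrier
  a ⁻¹⟨ a≉0 ⟩ = proj₁ (inverse a a≉0)

  *-inverseʳ : ∀ a (a≉0 : ¬ a ≈ 0#) → a * a ⁻¹⟨ a≉0 ⟩ ≈ 1#
  *-inverseʳ a a≉0 = proj₂ (inverse a a≉0)

  *-inverseˡ : ∀ a (a≉0 : ¬ a ≈ 0#) → a ⁻¹⟨ a≉0 ⟩ * a ≈ 1#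
  *-inverseˡ a a≉0 = trans (*-comm _ a) (*-inverseʳ a a≉0)

  *-cancelˡ : ∀ {a b d} → ¬ a ≈ 0# → a * b ≈ a * d → b ≈ d
  *-cancelˡ {a} {b} {d} a≉0 ab≈ad = begin
    b                 ≈⟨ sym (trans (*-congʳ (*-inverseˡ a a≉0)) (*-identityˡ b)) ⟩
    (a⁻¹ * a) * b     ≈⟨ *-assoc a⁻¹ a b ⟩
    a⁻¹ * (a * b)     ≈⟨ *-congˡ ab≈ad ⟩
    a⁻¹ * (a * d)     ≈⟨ sym (*-assoc a⁻¹ a d) ⟩
    (a⁻¹ * a) * d     ≈⟨ trans (*-congʳ (*-inverseˡ a a≉0)) (*-identityˡ d) ⟩
    d                 ∎
    where
    a⁻¹ : Carrier
    a⁻¹ = a ⁻¹⟨ a≉0 ⟩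

  zero-product : ∀ {a b} → ¬ a ≈ 0# → a * b ≈ 0# → b ≈ 0#
  zero-product a≉0 ab≈0 = *-cancelˡ a≉0 (trans ab≈0 (sym (zeroʳ _)))

  nonzero-product : ∀ {a b} → ¬ a ≈ 0# → ¬ b ≈ 0# → ¬ a * b ≈ 0#
  nonzero-product a≉0 b≉0 ab≈0 = b≉0 (zero-product a≉0 ab≈0)

  inverse-nonzero : ∀ a (a≉0 : ¬ a ≈ 0#) → ¬ a ⁻¹⟨ a≉0 ⟩ ≈ 0#
  inverse-nonzero a a≉0 a⁻¹≈0 = 0≉1 (trans (sym (trans (*-congˡ a⁻¹≈0) (zeroʳ a))) (*-inverseʳ a a≉0))

  difference-zero : ∀ {x y} → x - y ≈ 0# → x ≈ y
  difference-zero {x} {y} h = begin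
    x              ≈⟨ solve 2 (λ x y → x := (x :- y) :+ y) refl x y ⟩
    (x - y) + y    ≈⟨ +-congʳ h ⟩
    0# + y         ≈⟨ +-identityˡ y ⟩
    y              ∎

  −-cancelˡ : ∀ {x y z} → x - y ≈ x - z → y ≈ z
  −-cancelˡ {x} {y} {z} h = begin
    y             ≈⟨ solve 2 (λ x y → y := x :- (x :- y)) refl x y ⟩
    x - (x - y)   ≈⟨ +-congˡ (-‿cong h) ⟩
    x - (x - z)   ≈⟨ solve 2 (λ x z → x :- (x :- z) := z) refl x z ⟩
    z             ∎

module Spans {c ℓ} (F : Field c ℓ) (M : ℕ) where
  open Field F
  open PG F M
  open FieldFacts F
  open IntegerCoefficientSolver commutativeRing using (solve; _:=_; _:+_; _:*_)

  ≈ᵥ-refl : ∀ {u} → u ≈ᵥ u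
  ≈ᵥ-refl i = refl

  ≈ᵥ-sym : ∀ {u v} → u ≈ᵥ v → v ≈ᵥ u
  ≈ᵥ-sym p i = sym (p i)

  ≈ᵥ-trans : ∀ {u v w} → u ≈ᵥ v → v ≈ᵥ w → u ≈ᵥ w
  ≈ᵥ-trans p q i = trans (p i) (q i)

  +ᵥ-cong : ∀ {u u′ v v′} → u ≈ᵥ u′ → v ≈ᵥ v′ → (u +ᵥ v) ≈ᵥ (u′ +ᵥ v′)
  +ᵥ-cong p q i = +-cong (p i) (q i)

  ·-congˡ : ∀ a {u v} → u ≈ᵥ v → (a · u) ≈ᵥ (a · v)
  ·-congˡ a p i = *-congˡ (p i)

  ≐-refl : ∀ {S} → S ≐ S
  ≐-refl v = (λ p → p) , (λ p → p)

  ≐-sym : ∀ {S T} → S ≐ T → T ≐ S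
  ≐-sym h v = proj₂ (h v) , proj₁ (h v)

  ≐-trans : ∀ {S T U} → S ≐ T → T ≐ U → S ≐ U
  ≐-trans h g v = (λ p → proj₁ (g v) (proj₁ (h v) p)) , (λ p → proj₂ (h v) (proj₂ (g v) p))

  ⊕-cong : ∀ {S S′ T T′} → S ≐ S′ → T ≐ T′ → (S ⊕ T) ≐ (S′ ⊕ T′)
  ⊕-cong h g v = (λ { (s , t , ps , pt , e) → s , t , proj₁ (h s) ps , proj₁ (g t) pt , e })
               , (λ { (s , t , ps , pt , e) → s , t , proj₂ (h s) ps , proj₂ (g t) pt , e })

  ∩-cong : ∀ {S S′ T T′} → S ≐ S′ → T ≐ T′ → (S ∩ T) ≐ (S′ ∩ T′)
  ∩-cong h g v = (λ { (p , q) → proj₁ (h v) p , proj₁ (g v) q })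
               , (λ { (p , q) → proj₂ (h v) p , proj₂ (g v) q })

  ⊆-antisym : ∀ {S T} → S ⊆ T → T ⊆ S → S ≐ T
  ⊆-antisym S⊆T T⊆S v = S⊆T v , T⊆S v

  lincomb-+ : ∀ {m} (cs ds : Vec Carrier m) vs →
              lincomb (zipWith _+_ cs ds) vs ≈ᵥ (lincomb cs vs +ᵥ lincomb ds vs)
  lincomb-+ [] [] [] i = sym (+-identityʳ 0#)
  lincomb-+ (c ∷ cs) (d ∷ ds) (v ∷ vs) i =
    trans (+-congˡ (lincomb-+ cs ds vs i))
      (solve 5 (λ c d v l l′ → (c :+ d) :* v :+ (l :+ l′) := (c :* v :+ l) :+ (d :* v :+ l′))
         refl c d (v i) (lincomb cs vs i) (lincomb ds vs i))

  lincomb-· : ∀ {m} a (cs : Vec Carrier m) vs → lincomb (Vec.map (a *_) cs) vs ≈ᵥ (a · lincomb cs vs)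
  lincomb-· a [] [] i = sym (zeroʳ a)
  lincomb-· a (c ∷ cs) (v ∷ vs) i =
    trans (+-congˡ (lincomb-· a cs vs i))
      (solve 4 (λ a c v l → (a :* c) :* v :+ a :* l := a :* (c :* v :+ l)) refl a c (v i) (lincomb cs vs i))

  lincomb-0 : ∀ {m} (vs : Vec Vect m) → lincomb (replicate m 0#) vs ≈ᵥ 0ᵥ
  lincomb-0 [] i = refl
  lincomb-0 (v ∷ vs) i = trans (+-cong (zeroˡ (v i)) (lincomb-0 vs i)) (+-identityʳ 0#)

  span-resp : ∀ {m} {vs : Vec Vect m} {u v} → u ≈ᵥ v → Span vs u → Span vs v
  span-resp u≈v (cs , u≈) = cs , ≈ᵥ-trans (≈ᵥ-sym u≈v) u≈

  span-+ : ∀ {m} {vs : Vec Vect m} {u v} → Span vs u → Span vs v → Span vs (u +ᵥ v)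
  span-+ {vs = vs} (cs , u≈) (ds , v≈) =
    zipWith _+_ cs ds , ≈ᵥ-trans (+ᵥ-cong u≈ v≈) (≈ᵥ-sym (lincomb-+ cs ds vs))

  span-· : ∀ {m} {vs : Vec Vect m} a {u} → Span vs u → Span vs (a · u)
  span-· {vs = vs} a (cs , u≈) = Vec.map (a *_) cs , ≈ᵥ-trans (·-congˡ a u≈) (≈ᵥ-sym (lincomb-· a cs vs))

  span-generator : ∀ {m} (vs : Vec Vect m) s → Span vs (lookup vs s)
  span-generator (v ∷ vs) Fin.zero = (1# ∷ replicate _ 0#) ,
    λ i → sym (trans (+-cong (*-identityˡ (v i)) (lincomb-0 vs i)) (+-identityʳ (v i)))
  span-generator (v ∷ vs) (Fin.suc s) with span-generator vs s
  ... | cs , e = (0# ∷ cs) , λ i → trans (e i) (sym (trans (+-congʳ (zeroˡ (v i))) (+-identityˡ _)))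

  lincomb-∈ : ∀ {m k} {vs : Vec Vect m} {ws : Vec Vect k} →
              (∀ s → Span ws (lookup vs s)) → ∀ cs → Span ws (lincomb cs vs)
  lincomb-∈ {vs = []} {ws} gen [] = replicate _ 0# , ≈ᵥ-sym (lincomb-0 ws)
  lincomb-∈ {vs = v ∷ vs} gen (c ∷ cs) =
    span-+ (span-· c (gen Fin.zero)) (lincomb-∈ (λ s → gen (Fin.suc s)) cs)

  span-⊆ : ∀ {m k} {vs : Vec Vect m} {ws : Vec Vect k} →
           (∀ s → Span ws (lookup vs s)) → Span vs ⊆ Span ws
  span-⊆ gen v (cs , v≈) = span-resp (≈ᵥ-sym v≈) (lincomb-∈ gen cs)

  point-cong : ∀ {u v} → u ≈ᵥ v → ⟨ u ⟩ ≐ ⟨ v ⟩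
  point-cong {u} {v} u≈v = ⊆-antisym (span-⊆ λ { Fin.zero → span-resp (≈ᵥ-sym u≈v) (span-generator (v ∷ []) Fin.zero) })
                                     (span-⊆ λ { Fin.zero → span-resp u≈v (span-generator (u ∷ []) Fin.zero) })

  point-scale : ∀ {u} s → ¬ s ≈ 0# → ⟨ s · u ⟩ ≐ ⟨ u ⟩
  point-scale {u} s s≉0 = ⊆-antisym
    (span-⊆ λ { Fin.zero → span-· s (span-generator (u ∷ []) Fin.zero) })
    (span-⊆ λ { Fin.zero → span-resp back (span-· (s ⁻¹⟨ s≉0 ⟩) (span-generator ((s · u) ∷ []) Fin.zero)) })
    where
    back : (s ⁻¹⟨ s≉0 ⟩ · (s · u)) ≈ᵥ u
    back i = trans (sym (*-assoc _ s (u i))) (trans (*-congʳ (*-inverseˡ s s≉0)) (*-identityˡ (u i)))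

  independent-nonzero : ∀ {v} → LinIndep (v ∷ []) → ¬ v ≈ᵥ 0ᵥ
  independent-nonzero {v} indep v≈0 with indep (1# ∷ []) (λ i → trans (+-identityʳ _) (trans (*-identityˡ (v i)) (v≈0 i)))
  ... | 1≈0 ∷ [] = 0≉1 (sym 1≈0)

-- Coordinates with respect to the points x_0, ..., x_M: a coefficient
-- function f : ℕ → K stands for the vector ⟦ f ⟧ = Σ_{i≤M} f i · x_i.
module Coordinates {c ℓ} (F : Field c ℓ) (M : ℕ) (x : ℕ → PG.Vect F M) where
  open Field F
  open PG F M
  open IntegerCoefficientSolver commutativeRing using (solve; _:=_; _:+_; _:*_; _:-_; :-_; con)
  open Spans F M
  open FieldFacts F
  open import Relation.Binary.Reasoning.Setoid setoid

  Coef : Set c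
  Coef = ℕ → Carrier

  segment : Coef → ℕ → ℕ → Vect
  segment f a zero = 0ᵥ
  segment f a (suc n) = (f 0 · x a) +ᵥ segment (λ i → f (suc i)) (suc a) n

  ⟦_⟧ : Coef → Vect
  ⟦ f ⟧ = segment f 0 (suc M)

  segment-cong : ∀ {f g} a n → (∀ i → f i ≈ g i) → segment f a n ≈ᵥ segment g a n
  segment-cong a zero f≈g = ≈ᵥ-refl
  segment-cong a (suc n) f≈g i = +-cong (*-congʳ (f≈g 0)) (segment-cong (suc a) n (λ j → f≈g (suc j)) i)

  segment-+ : ∀ f g a n → segment (λ i → f i + g i) a n ≈ᵥ (segment f a n +ᵥ segment g a n)
  segment-+ f g a zero i = sym (+-identityʳ 0#)
  segment-+ f g a (suc n) i =
    trans (+-congˡ (segment-+ (λ j → f (suc j)) (λ j → g (suc j)) (suc a) n i))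
      (solve 5 (λ f g x s t → (f :+ g) :* x :+ (s :+ t) := (f :* x :+ s) :+ (g :* x :+ t))
         refl (f 0) (g 0) (x a i) _ _)

  segment-· : ∀ s f a n → segment (λ i → s * f i) a n ≈ᵥ (s · segment f a n)
  segment-· s f a zero i = sym (zeroʳ s)
  segment-· s f a (suc n) i =
    trans (+-congˡ (segment-· s (λ j → f (suc j)) (suc a) n i))
      (solve 4 (λ s f x t → (s :* f) :* x :+ s :* t := s :* (f :* x :+ t)) refl s (f 0) (x a i) _)

  segment-0 : ∀ f a n → (∀ i → f i ≈ 0#) → segment f a n ≈ᵥ 0ᵥ
  segment-0 f a zero f≈0 = ≈ᵥ-refl
  segment-0 f a (suc n) f≈0 i =
    trans (+-cong (trans (*-congʳ (f≈0 0)) (zeroˡ _)) (segment-0 _ (suc a) n (λ j → f≈0 (suc j)) i))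
      (+-identityʳ 0#)

  segment-truncate : ∀ f a n r → (∀ i → n ≤ i → f i ≈ 0#) → segment f a (n ℕ.+ r) ≈ᵥ segment f a n
  segment-truncate f a zero r f≈0 = segment-0 f a r (λ i → f≈0 i z≤n)
  segment-truncate f a (suc n) r f≈0 i =
    +-congˡ (segment-truncate (λ j → f (suc j)) (suc a) n r (λ j p → f≈0 (suc j) (s≤s p)) i)

  segment-drop : ∀ f b a m → (∀ i → i < a → f i ≈ 0#) →
                 segment f b (a ℕ.+ m) ≈ᵥ segment (λ i → f (a ℕ.+ i)) (a ℕ.+ b) m
  segment-drop f b zero m f≈0 = ≈ᵥ-refl
  segment-drop f b (suc a) m f≈0 i =
    trans (+-cong (trans (*-congʳ (f≈0 0 (s≤s z≤n))) (zeroˡ _)) (rest i)) (+-identityˡ _)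
    where
    rest : segment (λ j → f (suc j)) (suc b) (a ℕ.+ m) ≈ᵥ segment (λ j → f (suc a ℕ.+ j)) (suc a ℕ.+ b) m
    rest = P.subst (λ z → segment (λ j → f (suc j)) (suc b) (a ℕ.+ m) ≈ᵥ segment (λ j → f (suc a ℕ.+ j)) z m)
             (ℕₚ.+-suc a b) (segment-drop (λ j → f (suc j)) (suc b) a m (λ j p → f≈0 (suc j) (s≤s p)))

  ⟦⟧-cong : ∀ {f g} → (∀ i → f i ≈ g i) → ⟦ f ⟧ ≈ᵥ ⟦ g ⟧
  ⟦⟧-cong = segment-cong 0 (suc M)

  ⟦⟧-+ : ∀ f g → (⟦ f ⟧ +ᵥ ⟦ g ⟧) ≈ᵥ ⟦ (λ i → f i + g i) ⟧
  ⟦⟧-+ f g = ≈ᵥ-sym (segment-+ f g 0 (suc M))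

  ⟦⟧-· : ∀ s f → (s · ⟦ f ⟧) ≈ᵥ ⟦ (λ i → s * f i) ⟧
  ⟦⟧-· s f = ≈ᵥ-sym (segment-· s f 0 (suc M))

  ⟦⟧-0 : 0ᵥ ≈ᵥ ⟦ (λ _ → 0#) ⟧
  ⟦⟧-0 = ≈ᵥ-sym (segment-0 _ 0 (suc M) (λ _ → refl))

  Supported : ℕ → ℕ → Coef → Set ℓ
  Supported a n f = (∀ i → i < a → f i ≈ 0#) × (∀ i → a ℕ.+ n ≤ i → f i ≈ 0#)

  ⟦⟧-supported : ∀ a n f → a ℕ.+ n ≤ suc M → Supported a n f → ⟦ f ⟧ ≈ᵥ segment (λ i → f (a ℕ.+ i)) a n
  ⟦⟧-supported a n f a+n≤ (below , above) =
    ≈ᵥ-trans whole (≈ᵥ-trans (drop′ (segment-drop f 0 a m below)) (restrict (segment-truncate (λ i → f (a ℕ.+ i)) a n r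
      (λ i p → above (a ℕ.+ i) (ℕₚ.+-monoʳ-≤ a p)))))
    where
    m r : ℕ
    m = suc M ∸ a
    r = m ∸ n
    a+m≡ : a ℕ.+ m ≡ suc M
    a+m≡ = ℕₚ.m+[n∸m]≡n (ℕₚ.≤-trans (ℕₚ.m≤m+n a n) a+n≤)
    n+r≡ : n ℕ.+ r ≡ m
    n+r≡ = ℕₚ.m+[n∸m]≡n (ℕₚ.+-cancelˡ-≤ a n m (P.subst (a ℕ.+ n ≤_) (P.sym a+m≡) a+n≤))
    whole : ⟦ f ⟧ ≈ᵥ segment f 0 (a ℕ.+ m)
    whole = P.subst (λ z → ⟦ f ⟧ ≈ᵥ segment f 0 z) (P.sym a+m≡) ≈ᵥ-refl
    drop′ : segment f 0 (a ℕ.+ m) ≈ᵥ segment (λ i → f (a ℕ.+ i)) (a ℕ.+ 0) m →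
            segment f 0 (a ℕ.+ m) ≈ᵥ segment (λ i → f (a ℕ.+ i)) a m
    drop′ = P.subst (λ z → segment f 0 (a ℕ.+ m) ≈ᵥ segment (λ i → f (a ℕ.+ i)) z m) (ℕₚ.+-identityʳ a)
    restrict : segment (λ i → f (a ℕ.+ i)) a (n ℕ.+ r) ≈ᵥ segment (λ i → f (a ℕ.+ i)) a n →
               segment (λ i → f (a ℕ.+ i)) a m ≈ᵥ segment (λ i → f (a ℕ.+ i)) a n
    restrict = P.subst (λ z → segment (λ i → f (a ℕ.+ i)) a z ≈ᵥ segment (λ i → f (a ℕ.+ i)) a n) n+r≡

  toVec : Coef → (n : ℕ) → Vec Carrier n
  toVec f zero = []
  toVec f (suc n) = f 0 ∷ toVec (λ i → f (suc i)) n

  fromVec : ∀ {n} → Vec Carrier n → Coef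
  fromVec [] i = 0#
  fromVec (c ∷ cs) zero = c
  fromVec (c ∷ cs) (suc i) = fromVec cs i

  lincomb-toVec : ∀ f a n → lincomb (toVec f n) (range x a n) ≡ segment f a n
  lincomb-toVec f a zero = P.refl
  lincomb-toVec f a (suc n) = P.cong ((f 0 · x a) +ᵥ_) (lincomb-toVec (λ i → f (suc i)) (suc a) n)

  lincomb-fromVec : ∀ {n} (cs : Vec Carrier n) a → lincomb cs (range x a n) ≡ segment (fromVec cs) a n
  lincomb-fromVec [] a = P.refl
  lincomb-fromVec (c ∷ cs) a = P.cong ((c · x a) +ᵥ_) (lincomb-fromVec cs (suc a))

  fromVec-beyond : ∀ {n} (cs : Vec Carrier n) i → n ≤ i → fromVec cs i ≡ 0#
  fromVec-beyond [] i p = P.refl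
  fromVec-beyond (c ∷ cs) (suc i) (s≤s p) = fromVec-beyond cs i p

  toVec-zero : ∀ f n → All (λ a → a ≈ 0#) (toVec f n) → ∀ i → i < n → f i ≈ 0#
  toVec-zero f (suc n) (p ∷ ps) zero q = p
  toVec-zero f (suc n) (p ∷ ps) (suc i) (s≤s q) = toVec-zero (λ j → f (suc j)) n ps i q

  shift : ℕ → Coef → Coef
  shift zero f = f
  shift (suc a) f zero = 0#
  shift (suc a) f (suc i) = shift a f i

  shift-below : ∀ a f i → i < a → shift a f i ≡ 0#
  shift-below (suc a) f zero p = P.refl
  shift-below (suc a) f (suc i) (s≤s p) = shift-below a f i p

  shift-at : ∀ a f i → shift a f (a ℕ.+ i) ≡ f i
  shift-at zero f i = P.refl
  shift-at (suc a) f i = shift-at a f i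

  shift-above : ∀ a f i → a ≤ i → shift a f i ≡ f (i ∸ a)
  shift-above zero f i p = P.refl
  shift-above (suc a) f (suc i) (s≤s p) = shift-above a f i p

  span-range→ : ∀ a n {v} → a ℕ.+ n ≤ suc M → Span (range x a n) v → ∃ λ f → Supported a n f × (v ≈ᵥ ⟦ f ⟧)
  span-range→ a n a+n≤ (cs , v≈) = f , (below , above) ,
    ≈ᵥ-trans v≈ (P.subst (_≈ᵥ ⟦ f ⟧) (P.sym (lincomb-fromVec cs a))
      (≈ᵥ-sym (≈ᵥ-trans (⟦⟧-supported a n f a+n≤ (below , above))
                        (segment-cong a n (λ i → reflexive (shift-at a (fromVec cs) i))))))
    where
    f : Coef
    f = shift a (fromVec cs)
    below : ∀ i → i < a → f i ≈ 0#
    below i p = reflexive (shift-below a (fromVec cs) i p)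
    above : ∀ i → a ℕ.+ n ≤ i → f i ≈ 0#
    above i p = reflexive (P.trans (shift-above a (fromVec cs) i (ℕₚ.≤-trans (ℕₚ.m≤m+n a n) p))
      (fromVec-beyond cs (i ∸ a) (P.subst (_≤ i ∸ a) (ℕₚ.m+n∸m≡n a n) (ℕₚ.∸-monoˡ-≤ a p))))

  span-range← : ∀ a n f {v} → a ℕ.+ n ≤ suc M → Supported a n f → v ≈ᵥ ⟦ f ⟧ → Span (range x a n) v
  span-range← a n f a+n≤ supp v≈ = toVec (λ i → f (a ℕ.+ i)) n ,
    ≈ᵥ-trans v≈ (≈ᵥ-trans (⟦⟧-supported a n f a+n≤ supp)
      (P.subst (segment (λ i → f (a ℕ.+ i)) a n ≈ᵥ_) (P.sym (lincomb-toVec _ a n)) ≈ᵥ-refl))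

  δ : ℕ → Coef
  δ zero zero = 1#
  δ zero (suc i) = 0#
  δ (suc j) zero = 0#
  δ (suc j) (suc i) = δ j i

  δ-same : ∀ j → δ j j ≡ 1#
  δ-same zero = P.refl
  δ-same (suc j) = δ-same j

  δ-other : ∀ j i → i ≢ j → δ j i ≡ 0#
  δ-other zero zero i≢j = ⊥-elim (i≢j P.refl)
  δ-other zero (suc i) i≢j = P.refl
  δ-other (suc j) zero i≢j = P.refl
  δ-other (suc j) (suc i) i≢j = δ-other j i (λ e → i≢j (P.cong suc e))

  δ-below : ∀ {i j} → i < j → δ j i ≡ 0#
  δ-below {i} {j} i<j = δ-other j i (λ e → ℕₚ.<-irrefl e i<j)

  δ-above : ∀ {i j} → j < i → δ j i ≡ 0#
  δ-above {i} {j} j<i = δ-other j i (λ e → ℕₚ.<-irrefl (P.sym e) j<i)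

  ⟦δ⟧ : ∀ j → j ≤ M → ⟦ δ j ⟧ ≈ᵥ x j
  ⟦δ⟧ j j≤M i =
    trans (⟦⟧-supported j 1 (δ j) (P.subst (_≤ suc M) (ℕₚ.+-comm 1 j) (s≤s j≤M)) (below , above) i)
      (trans (+-identityʳ _) (trans (*-congʳ (reflexive (P.trans (P.cong (δ j) (ℕₚ.+-identityʳ j)) (δ-same j))))
        (*-identityˡ _)))
    where
    below : ∀ i → i < j → δ j i ≈ 0#
    below i i<j = reflexive (δ-below i<j)
    above : ∀ i → j ℕ.+ 1 ≤ i → δ j i ≈ 0#
    above i j+1≤i = reflexive (δ-above (P.subst (_≤ i) (ℕₚ.+-comm j 1) j+1≤i))

  comb : ∀ {m} → Vec Carrier m → (Fin m → Coef) → Coef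
  comb [] A i = 0#
  comb (c ∷ cs) A i = c * A Fin.zero i + comb cs (λ s → A (Fin.suc s)) i

  ⟪_⟫ : ∀ {m} → (Fin m → Coef) → Subspace
  ⟪ A ⟫ = Span (tabulate (λ s → ⟦ A s ⟧))

  lincomb-⟦⟧ : ∀ {m} (cs : Vec Carrier m) A → lincomb cs (tabulate (λ s → ⟦ A s ⟧)) ≈ᵥ ⟦ comb cs A ⟧
  lincomb-⟦⟧ [] A = ⟦⟧-0
  lincomb-⟦⟧ (c ∷ cs) A =
    ≈ᵥ-trans (+ᵥ-cong (⟦⟧-· c (A Fin.zero)) (lincomb-⟦⟧ cs (λ s → A (Fin.suc s))))
      (⟦⟧-+ (λ i → c * A Fin.zero i) (comb cs (λ s → A (Fin.suc s))))

  ⟪⟫→ : ∀ {m} (A : Fin m → Coef) {v} → ⟪ A ⟫ v → ∃ λ cs → v ≈ᵥ ⟦ comb cs A ⟧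
  ⟪⟫→ A (cs , v≈) = cs , ≈ᵥ-trans v≈ (lincomb-⟦⟧ cs A)

  ⟪⟫← : ∀ {m} (A : Fin m → Coef) {v} cs → v ≈ᵥ ⟦ comb cs A ⟧ → ⟪ A ⟫ v
  ⟪⟫← A cs v≈ = cs , ≈ᵥ-trans v≈ (≈ᵥ-sym (lincomb-⟦⟧ cs A))

  ⟪⟫-generator : ∀ {m} (A : Fin m → Coef) s → ⟪ A ⟫ ⟦ A s ⟧
  ⟪⟫-generator A s =
    P.subst ⟪ A ⟫ (Vecₚ.lookup∘tabulate (λ t → ⟦ A t ⟧) s) (span-generator (tabulate (λ t → ⟦ A t ⟧)) s)

  _◂_ : ∀ {m} → Coef → (Fin m → Coef) → Fin (suc m) → Coef
  (e ◂ A) Fin.zero = e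
  (e ◂ A) (Fin.suc s) = A s

  ⟨⟩⊕⟪⟫ : ∀ {m} e (A : Fin m → Coef) → (⟨ ⟦ e ⟧ ⟩ ⊕ ⟪ A ⟫) ≐ ⟪ e ◂ A ⟫
  ⟨⟩⊕⟪⟫ e A v = to , from
    where
    to : (⟨ ⟦ e ⟧ ⟩ ⊕ ⟪ A ⟫) v → ⟪ e ◂ A ⟫ v
    to (s , t , (l ∷ [] , s≈) , (cs , t≈) , v≈) =
      (l ∷ cs) , ≈ᵥ-trans v≈ (+ᵥ-cong (≈ᵥ-trans s≈ (λ i → +-identityʳ _)) t≈)
    from : ⟪ e ◂ A ⟫ v → (⟨ ⟦ e ⟧ ⟩ ⊕ ⟪ A ⟫) v
    from (l ∷ cs , v≈) = _ , _ , (l ∷ [] , ≈ᵥ-refl) , (cs , ≈ᵥ-refl) ,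
      ≈ᵥ-trans v≈ (+ᵥ-cong (λ i → sym (+-identityʳ _)) ≈ᵥ-refl)

  comb-congᶠ : ∀ {m} (cs : Vec Carrier m) {A B} i → (∀ s → A s i ≈ B s i) → comb cs A i ≈ comb cs B i
  comb-congᶠ [] i A≈B = refl
  comb-congᶠ (c ∷ cs) i A≈B = +-cong (*-congˡ (A≈B Fin.zero)) (comb-congᶠ cs i (λ s → A≈B (Fin.suc s)))

  comb-congᶜ : ∀ {m} (cs ds : Vec Carrier m) A i → (∀ s → lookup cs s ≈ lookup ds s) → comb cs A i ≈ comb ds A i
  comb-congᶜ [] [] A i cs≈ds = refl
  comb-congᶜ (c ∷ cs) (d ∷ ds) A i cs≈ds =
    +-cong (*-congʳ (cs≈ds Fin.zero)) (comb-congᶜ cs ds (λ s → A (Fin.suc s)) i (λ s → cs≈ds (Fin.suc s)))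

  comb-vanish : ∀ {m} (cs : Vec Carrier m) {A} i → (∀ s → A s i ≈ 0#) → comb cs A i ≈ 0#
  comb-vanish [] i A≈0 = refl
  comb-vanish (c ∷ cs) i A≈0 =
    trans (+-cong (trans (*-congˡ (A≈0 Fin.zero)) (zeroʳ c)) (comb-vanish cs i (λ s → A≈0 (Fin.suc s))))
      (+-identityʳ 0#)

  comb-0 : ∀ {m} (A : Fin m → Coef) i → comb (replicate m 0#) A i ≈ 0#
  comb-0 {zero} A i = refl
  comb-0 {suc m} A i = trans (+-cong (zeroˡ _) (comb-0 (λ s → A (Fin.suc s)) i)) (+-identityʳ 0#)

  unitVec : ∀ {m} → Fin m → Vec Carrier m
  unitVec {suc m} Fin.zero = 1# ∷ replicate m 0#
  unitVec (Fin.suc s) = 0# ∷ unitVec s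

  comb-unitVec : ∀ {m} (A : Fin m → Coef) s i → comb (unitVec s) A i ≈ A s i
  comb-unitVec A Fin.zero i =
    trans (+-cong (*-identityˡ _) (comb-0 (λ s → A (Fin.suc s)) i)) (+-identityʳ _)
  comb-unitVec A (Fin.suc s) i =
    trans (+-cong (zeroˡ _) (comb-unitVec (λ t → A (Fin.suc t)) s i)) (+-identityˡ _)

  single : Coef → Fin 1 → Coef
  single e s = e

  pair : Coef → Coef → Fin 2 → Coef
  pair e f Fin.zero = e
  pair e f (Fin.suc s) = f

  plane : Carrier → Carrier → Carrier → Coef
  plane a b c 0 = a
  plane a b c 1 = b
  plane a b c 2 = c
  plane a b c (suc (suc (suc i))) = 0#

  plane-top : ∀ a b c i → 3 ≤ i → plane a b c i ≈ 0#
  plane-top a b c 1 (s≤s ())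
  plane-top a b c 2 (s≤s (s≤s ()))
  plane-top a b c (suc (suc (suc i))) _ = refl

  plane-agree : ∀ a b c c′ i → i ≢ 2 → plane a b c i ≈ plane a b c′ i
  plane-agree a b c c′ 0 _ = refl
  plane-agree a b c c′ 1 _ = refl
  plane-agree a b c c′ 2 i≢2 = ⊥-elim (i≢2 P.refl)
  plane-agree a b c c′ (suc (suc (suc i))) _ = refl

  plane-cong : ∀ a b {c c′} → c ≈ c′ → ∀ i → plane a b c i ≈ plane a b c′ i
  plane-cong a b c≈c′ 2 = c≈c′
  plane-cong a b {c} {c′} c≈c′ i@0 = plane-agree a b c c′ i (λ ())
  plane-cong a b {c} {c′} c≈c′ i@1 = plane-agree a b c c′ i (λ ())
  plane-cong a b {c} {c′} c≈c′ i@(suc (suc (suc _))) = plane-agree a b c c′ i (λ ())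

  Determined : ∀ {m} → ℕ → (Fin m → Coef) → Set (c ⊔ ℓ)
  Determined {m} j A = ∀ (cs ds : Vec Carrier m) → (∀ i → i < j → comb cs A i ≈ comb ds A i) →
                       ∀ s → lookup cs s ≈ lookup ds s

  determined-mono : ∀ {m j j′} {A : Fin m → Coef} → j ≤ j′ → Determined j A → Determined j′ A
  determined-mono j≤j′ det cs ds agree = det cs ds (λ i i<j → agree i (ℕₚ.<-≤-trans i<j j≤j′))

  determined-transfer : ∀ {m j} {A B : Fin m → Coef} → (∀ s i → i < j → A s i ≈ B s i) →
                        Determined j A → Determined j B
  determined-transfer {A = A} {B} A≈B det cs ds agree = det cs ds λ i i<j →
    trans (comb-congᶠ cs i (λ s → A≈B s i i<j))
      (trans (agree i i<j) (sym (comb-congᶠ ds i (λ s → A≈B s i i<j))))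

  step : Carrier → ℕ → Coef → Coef → Coef
  step κ j A B i = A i + (κ * (A j - B j)) * δ (suc j) i

  comb-step : ∀ {m} (cs : Vec Carrier m) κ j (A B : Fin m → Coef) i →
              comb cs (λ s → step κ j (A s) (B s)) i ≈
              comb cs A i + (κ * (comb cs A j - comb cs B j)) * δ (suc j) i
  comb-step [] κ j A B i =
    solve 2 (λ κ d → con (0 , 0) := con (0 , 0) :+ (κ :* (con (0 , 0) :- con (0 , 0))) :* d) refl κ (δ (suc j) i)
  comb-step (c ∷ cs) κ j A B i =
    trans (+-congˡ (comb-step cs κ j (λ s → A (Fin.suc s)) (λ s → B (Fin.suc s)) i))
      (solve 9 (λ c a aj bj κ d x xj yj →
                  c :* (a :+ (κ :* (aj :- bj)) :* d) :+ (x :+ (κ :* (xj :- yj)) :* d)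
               := (c :* a :+ x) :+ (κ :* ((c :* aj :+ xj) :- (c :* bj :+ yj))) :* d)
         refl c (A Fin.zero i) (A Fin.zero j) (B Fin.zero j) κ (δ (suc j) i)
         (comb cs (λ s → A (Fin.suc s)) i) (comb cs (λ s → A (Fin.suc s)) j) (comb cs (λ s → B (Fin.suc s)) j))

  comb-split : ∀ {m} (cs : Vec Carrier m) j (A B : Fin m → Coef) → (∀ s i → i ≢ j → A s i ≈ B s i) →
               ∀ i → comb cs A i ≈ comb cs B i + (comb cs A j - comb cs B j) * δ j i
  comb-split cs j A B A≈B i with i ℕ.≟ j
  ... | yes P.refl = trans (solve 2 (λ a b → a := b :+ (a :- b) :* con (1 , 0)) refl (comb cs A i) (comb cs B i))
                       (+-congˡ (*-congˡ (reflexive (P.sym (δ-same i)))))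
  ... | no i≢j = trans (comb-congᶠ cs i (λ s → A≈B s i i≢j))
                   (trans (solve 2 (λ b d → b := b :+ d :* con (0 , 0)) refl (comb cs B i) (comb cs A j - comb cs B j))
                     (+-congˡ (*-congˡ (reflexive (P.sym (δ-other j i i≢j))))))

  module Independent (indep : LinIndep (range x 0 (suc M))) where

    ⟦⟧-zero : ∀ f → ⟦ f ⟧ ≈ᵥ 0ᵥ → ∀ i → i ≤ M → f i ≈ 0#
    ⟦⟧-zero f f≈0 i i≤M =
      toVec-zero f (suc M) (indep (toVec f (suc M)) (P.subst (_≈ᵥ 0ᵥ) (P.sym (lincomb-toVec f 0 (suc M))) f≈0))
        i (s≤s i≤M)

    ⟦⟧-injective : ∀ f g → ⟦ f ⟧ ≈ᵥ ⟦ g ⟧ → ∀ i → i ≤ M → f i ≈ g i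
    ⟦⟧-injective f g f≈g i i≤M = begin
      f i                         ≈⟨ solve 2 (λ a b → a := (a :+ (:- con (1 , 0)) :* b) :+ b) refl (f i) (g i) ⟩
      (f i + (- 1#) * g i) + g i  ≈⟨ +-congʳ (⟦⟧-zero (λ j → f j + (- 1#) * g j) difference≈0 i i≤M) ⟩
      0# + g i                    ≈⟨ +-identityˡ (g i) ⟩
      g i                         ∎
      where
      difference≈0 : ⟦ (λ j → f j + (- 1#) * g j) ⟧ ≈ᵥ 0ᵥ
      difference≈0 = ≈ᵥ-trans (≈ᵥ-sym (⟦⟧-+ f (λ j → (- 1#) * g j))) (≈ᵥ-trans (+ᵥ-cong f≈g (≈ᵥ-sym (⟦⟧-· (- 1#) g)))
                       (λ j → solve 1 (λ a → a :+ (:- con (1 , 0)) :* a := con (0 , 0)) refl (⟦ g ⟧ j)))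

    determined-independent : ∀ {m j} {A : Fin m → Coef} → j ≤ suc M → Determined j A →
                             LinIndep (tabulate (λ s → ⟦ A s ⟧))
    determined-independent {m} {j} {A} j≤ det cs comb≈0 =
      Allₚ.lookup⁻ λ s → trans (det cs (replicate m 0#) below s) (reflexive (Vecₚ.lookup-replicate s 0#))
      where
      below : ∀ i → i < j → comb cs A i ≈ comb (replicate m 0#) A i
      below i i<j = trans (⟦⟧-zero (comb cs A) (≈ᵥ-trans (≈ᵥ-sym (lincomb-⟦⟧ cs A)) comb≈0) i
                            (ℕₚ.≤-pred (ℕₚ.≤-trans i<j j≤)))
                      (sym (comb-0 A i))

    generators-unique : ∀ {m j} {A B : Fin m → Coef} → j ≤ suc M → Determined j B →
                        (∀ s i → i < j → A s i ≈ B s i) → ⟪ A ⟫ ⊆ ⟪ B ⟫ → ∀ s i → i ≤ M → A s i ≈ B s i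
    generators-unique {j = j} {A} {B} j≤ det A≈B A⊆B s i i≤M with ⟪⟫→ B (A⊆B _ (⟪⟫-generator A s))
    ... | cs , As≈ = begin
      A s i                 ≈⟨ ⟦⟧-injective (A s) (comb cs B) As≈ i i≤M ⟩
      comb cs B i           ≈⟨ comb-congᶜ cs (unitVec s) B i (det cs (unitVec s) below) ⟩
      comb (unitVec s) B i  ≈⟨ comb-unitVec B s i ⟩
      B s i                 ∎
      where
      below : ∀ i → i < j → comb cs B i ≈ comb (unitVec s) B i
      below i i<j = trans (sym (⟦⟧-injective (A s) (comb cs B) As≈ i (ℕₚ.≤-pred (ℕₚ.≤-trans i<j j≤))))
                      (trans (A≈B s i i<j) (sym (comb-unitVec B s i)))

    module Meet {m} (j : ℕ) (j+1≤M : suc j ≤ M) (A B : Fin m → Coef)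
                (A-top : ∀ s → A s (suc j) ≈ 0#) (B-top : ∀ s → B s (suc j) ≈ 0#)
                (A≈B : ∀ s i → i ≢ j → A s i ≈ B s i) (det : Determined j A)
                (α β κ : Carrier) (α≉0 : ¬ α ≈ 0#) (κα≈β : κ * α ≈ β) where

      ι : Carrier
      ι = α ⁻¹⟨ α≉0 ⟩

      Y : Coef
      Y i = α * δ j i + β * δ (suc j) i

      C : Fin m → Coef
      C s = step κ j (A s) (B s)

      j≤M : j ≤ M
      j≤M = ℕₚ.<⇒≤ j+1≤M

      j<1+j : j < suc j
      j<1+j = ℕₚ.n<1+n j

      Y-below : ∀ i → i < j → Y i ≈ 0#
      Y-below i i<j = trans (+-cong (*-congˡ (reflexive (δ-below i<j))) (*-congˡ (reflexive (δ-below (ℕₚ.m<n⇒m<1+n i<j)))))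
                        (solve 2 (λ α β → α :* con (0 , 0) :+ β :* con (0 , 0) := con (0 , 0)) refl α β)

      Y-at-j : Y j ≈ α
      Y-at-j = trans (+-cong (*-congˡ (reflexive (δ-same j))) (*-congˡ (reflexive (δ-below j<1+j))))
                 (solve 2 (λ α β → α :* con (1 , 0) :+ β :* con (0 , 0) := α) refl α β)

      Y-at-1+j : Y (suc j) ≈ β
      Y-at-1+j = trans (+-cong (*-congˡ (reflexive (δ-above j<1+j))) (*-congˡ (reflexive (δ-same (suc j)))))
                   (solve 2 (λ α β → α :* con (0 , 0) :+ β :* con (1 , 0) := β) refl α β)

      ⊆C : ∀ v → (⟪ δ (suc j) ◂ A ⟫ ∩ ⟪ Y ◂ B ⟫) v → ⟪ C ⟫ v
      ⊆C v (p , q) with ⟪⟫→ (δ (suc j) ◂ A) p | ⟪⟫→ (Y ◂ B) q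
      ... | l ∷ cs , v≈ | n ∷ ds , v≈′ = ⟪⟫← C cs (≈ᵥ-trans v≈ (⟦⟧-cong λ i → begin
            l * δ (suc j) i + comb cs A i                      ≈⟨ +-cong (*-congʳ l≈κΔ) refl ⟩
            (κ * (comb cs A j - comb cs B j)) * δ (suc j) i + comb cs A i
                                                               ≈⟨ +-comm _ _ ⟩
            comb cs A i + (κ * (comb cs A j - comb cs B j)) * δ (suc j) i
                                                               ≈⟨ sym (comb-step cs κ j A B i) ⟩
            comb cs C i                                        ∎))
        where
        coord : ∀ i → i ≤ M → l * δ (suc j) i + comb cs A i ≈ n * Y i + comb ds B i
        coord = ⟦⟧-injective (comb (l ∷ cs) (δ (suc j) ◂ A)) (comb (n ∷ ds) (Y ◂ B)) (≈ᵥ-trans (≈ᵥ-sym v≈) v≈′)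
        -- below j both sides reduce to combinations of A, so the coefficients agree
        cs≈ds : ∀ s → lookup cs s ≈ lookup ds s
        cs≈ds = det cs ds λ i i<j → begin
          comb cs A i                        ≈⟨ sym (trans (+-congʳ (trans (*-congˡ (reflexive (δ-below (ℕₚ.m<n⇒m<1+n i<j)))) (zeroʳ l)))
                                                      (+-identityˡ _)) ⟩
          l * δ (suc j) i + comb cs A i      ≈⟨ coord i (ℕₚ.<⇒≤ (ℕₚ.<-≤-trans i<j j≤M)) ⟩
          n * Y i + comb ds B i              ≈⟨ trans (+-congʳ (trans (*-congˡ (Y-below i i<j)) (zeroʳ n))) (+-identityˡ _) ⟩
          comb ds B i                        ≈⟨ sym (comb-congᶠ ds i (λ s → A≈B s i (λ e → ℕₚ.<-irrefl e i<j))) ⟩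
          comb ds A i                        ∎
        coord′ : ∀ i → i ≤ M → l * δ (suc j) i + comb cs A i ≈ n * Y i + comb cs B i
        coord′ i i≤M = trans (coord i i≤M) (+-congˡ (comb-congᶜ ds cs B i (λ s → sym (cs≈ds s))))
        l≈nβ : l ≈ n * β
        l≈nβ = begin
          l                                          ≈⟨ sym (trans (+-cong (*-identityʳ l) (comb-vanish cs (suc j) A-top)) (+-identityʳ l)) ⟩
          l * 1# + comb cs A (suc j)                 ≈⟨ +-congʳ (*-congˡ (reflexive (P.sym (δ-same (suc j))))) ⟩
          l * δ (suc j) (suc j) + comb cs A (suc j)  ≈⟨ coord′ (suc j) j+1≤M ⟩
          n * Y (suc j) + comb cs B (suc j)          ≈⟨ trans (+-cong (*-congˡ Y-at-1+j) (comb-vanish cs (suc j) B-top)) (+-identityʳ _) ⟩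
          n * β                                      ∎
        nα≈Δ : n * α ≈ comb cs A j - comb cs B j
        nα≈Δ = begin
          n * α                                 ≈⟨ solve 2 (λ a b → a := (a :+ b) :- b) refl (n * α) (comb cs B j) ⟩
          (n * α + comb cs B j) - comb cs B j   ≈⟨ +-congʳ (sym (+-congʳ (*-congˡ Y-at-j))) ⟩
          (n * Y j + comb cs B j) - comb cs B j ≈⟨ +-congʳ (sym (coord′ j j≤M)) ⟩
          (l * δ (suc j) j + comb cs A j) - comb cs B j
                                                ≈⟨ +-congʳ (trans (+-congʳ (trans (*-congˡ (reflexive (δ-below j<1+j))) (zeroʳ l)))
                                                                   (+-identityˡ _)) ⟩
          comb cs A j - comb cs B j             ∎
        l≈κΔ : l ≈ κ * (comb cs A j - comb cs B j)
        l≈κΔ = begin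
          l                   ≈⟨ l≈nβ ⟩
          n * β               ≈⟨ *-congˡ (sym κα≈β) ⟩
          n * (κ * α)         ≈⟨ solve 3 (λ n κ α → n :* (κ :* α) := κ :* (n :* α)) refl n κ α ⟩
          κ * (n * α)         ≈⟨ *-congˡ nα≈Δ ⟩
          κ * (comb cs A j - comb cs B j) ∎

      ⊇C : ∀ v → ⟪ C ⟫ v → (⟪ δ (suc j) ◂ A ⟫ ∩ ⟪ Y ◂ B ⟫) v
      ⊇C v p with ⟪⟫→ C p
      ... | cs , v≈ = ⟪⟫← (δ (suc j) ◂ A) (κ * Δ ∷ cs) (≈ᵥ-trans v≈ (⟦⟧-cong λ i → trans (comb-step cs κ j A B i) (+-comm _ _)))
                    , ⟪⟫← (Y ◂ B) (Δ * ι ∷ cs) (≈ᵥ-trans v≈ (⟦⟧-cong y-side))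
        where
        Δ : Carrier
        Δ = comb cs A j - comb cs B j
        y-side : ∀ i → comb cs C i ≈ (Δ * ι) * Y i + comb cs B i
        y-side i = begin
          comb cs C i                                             ≈⟨ comb-step cs κ j A B i ⟩
          comb cs A i + (κ * Δ) * δ (suc j) i                     ≈⟨ +-congʳ (comb-split cs j A B A≈B i) ⟩
          (comb cs B i + Δ * δ j i) + (κ * Δ) * δ (suc j) i       ≈⟨ +-cong (+-congˡ (*-congʳ Δ≈)) (*-congʳ (*-congˡ Δ≈)) ⟩
          (comb cs B i + (Δ * (ι * α)) * δ j i) + (κ * (Δ * (ι * α))) * δ (suc j) i
                                                                  ≈⟨ solve 7 (λ b Δ ι α κ d d′ →
                                                                         (b :+ (Δ :* (ι :* α)) :* d) :+ (κ :* (Δ :* (ι :* α))) :* d′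
                                                                      := (Δ :* ι) :* (α :* d :+ (κ :* α) :* d′) :+ b)
                                                                       refl (comb cs B i) Δ ι α κ (δ j i) (δ (suc j) i) ⟩
          (Δ * ι) * (α * δ j i + (κ * α) * δ (suc j) i) + comb cs B i
                                                                  ≈⟨ +-congʳ (*-congˡ (+-congˡ (*-congʳ κα≈β))) ⟩
          (Δ * ι) * Y i + comb cs B i                             ∎
          where
          Δ≈ : Δ ≈ Δ * (ι * α)
          Δ≈ = sym (trans (*-congˡ (*-inverseˡ α α≉0)) (*-identityʳ Δ))

      meet : ∀ {y} → y ≈ᵥ ⟦ Y ⟧ → ((⟨ x (suc j) ⟩ ⊕ ⟪ A ⟫) ∩ (⟨ y ⟩ ⊕ ⟪ B ⟫)) ≐ ⟪ C ⟫
      meet y≈ = ≐-trans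
        (∩-cong (≐-trans (⊕-cong (point-cong (≈ᵥ-sym (⟦δ⟧ (suc j) j+1≤M))) ≐-refl) (⟨⟩⊕⟪⟫ (δ (suc j)) A))
                (≐-trans (⊕-cong (point-cong y≈) ≐-refl) (⟨⟩⊕⟪⟫ Y B)))
        (λ v → ⊆C v , ⊇C v)

    ⟦⟧-injective-plane : 2 ≤ M → ∀ f g → (∀ i → 3 ≤ i → f i ≈ 0#) → (∀ i → 3 ≤ i → g i ≈ 0#) →
                         ⟦ f ⟧ ≈ᵥ ⟦ g ⟧ → ∀ i → f i ≈ g i
    ⟦⟧-injective-plane 2≤M f g f-top g-top f≈g 0 = ⟦⟧-injective f g f≈g 0 z≤n
    ⟦⟧-injective-plane 2≤M f g f-top g-top f≈g 1 = ⟦⟧-injective f g f≈g 1 (ℕₚ.≤-trans (s≤s z≤n) 2≤M)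
    ⟦⟧-injective-plane 2≤M f g f-top g-top f≈g 2 = ⟦⟧-injective f g f≈g 2 2≤M
    ⟦⟧-injective-plane 2≤M f g f-top g-top f≈g i@(suc (suc (suc _))) =
      trans (f-top i (s≤s (s≤s (s≤s z≤n)))) (sym (g-top i (s≤s (s≤s (s≤s z≤n)))))

    line-meets-π : ∀ j → j ≤ M → ∀ P Q → P 0 ≈ 0# → ¬ Q 0 ≈ 0# → (∀ i → suc j ≤ i → P i ≈ 0#) →
                   (⟪ pair P Q ⟫ ∩ πsp x j) ≐ ⟨ ⟦ P ⟧ ⟩
    line-meets-π j j≤M P Q P₀≈0 Q₀≉0 P-top v = to , from
      where
      to : (⟪ pair P Q ⟫ ∩ πsp x j) v → ⟨ ⟦ P ⟧ ⟩ v
      to (p , q) with ⟪⟫→ (pair P Q) p | span-range→ 1 j (s≤s j≤M) q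
      ... | a ∷ b ∷ [] , v≈ | f , (f-below , _) , v≈′ =
        ⟪⟫← (single P) (a ∷ []) (≈ᵥ-trans v≈ (⟦⟧-cong {comb (a ∷ b ∷ []) (pair P Q)} λ i → +-congˡ (trans (+-congʳ (trans (*-congʳ b≈0) (zeroˡ (Q i)))) (+-identityˡ 0#))))
        where
        b≈0 : b ≈ 0#
        b≈0 = zero-product Q₀≉0 (begin
          Q 0 * b                       ≈⟨ solve 4 (λ a b p q → q :* b := (a :* p :+ (b :* q :+ con (0 , 0))) :- a :* p) refl a b (P 0) (Q 0) ⟩
          comb (a ∷ b ∷ []) (pair P Q) 0 - a * P 0
                                        ≈⟨ +-cong (⟦⟧-injective (comb (a ∷ b ∷ []) (pair P Q)) f (≈ᵥ-trans (≈ᵥ-sym v≈) v≈′) 0 z≤n) (-‿cong (*-congˡ P₀≈0)) ⟩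
          f 0 - a * 0#                  ≈⟨ +-cong (f-below 0 (s≤s z≤n)) (-‿cong (zeroʳ a)) ⟩
          0# - 0#                       ≈⟨ -‿inverseʳ 0# ⟩
          0#                            ∎)
      from : ⟨ ⟦ P ⟧ ⟩ v → (⟪ pair P Q ⟫ ∩ πsp x j) v
      from p with ⟪⟫→ (single P) p
      ... | a ∷ [] , v≈ =
          ⟪⟫← (pair P Q) (a ∷ 0# ∷ []) (≈ᵥ-trans v≈ (⟦⟧-cong {comb (a ∷ []) (single P)} λ i → +-congˡ (sym (trans (+-congʳ (zeroˡ (Q i))) (+-identityˡ 0#)))))
        , span-range← 1 j (comb (a ∷ []) (single P)) (s≤s j≤M) (below , above) v≈
        where
        below : ∀ i → i < 1 → a * P i + 0# ≈ 0#
        below 0 _ = trans (+-identityʳ _) (trans (*-congˡ P₀≈0) (zeroʳ a))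
        below (suc i) (s≤s ())
        above : ∀ i → 1 ℕ.+ j ≤ i → a * P i + 0# ≈ 0#
        above i j<i = trans (+-identityʳ _) (trans (*-congˡ (P-top i j<i)) (zeroʳ a))

    module NormalForm (2≤M : 2 ≤ M) (L : Subspace) (L-line : IsLine L) (L⊆Σ₂ : L ⊆ Σsp x 2)
                      (Lπ-point : IsPoint (L ∩ πsp x 2)) (Lπ≉x₂ : ¬ ((L ∩ πsp x 2) ≐ ⟨ x 2 ⟩)) where

      3≤1+M : 3 ≤ suc M
      3≤1+M = s≤s 2≤M

      u w : Vect
      u = proj₁ L-line
      w = proj₁ (proj₂ L-line)

      L≐uw : L ≐ Span (u ∷ w ∷ [])
      L≐uw = proj₂ (proj₂ (proj₂ L-line))

      L-resp : ∀ {v v′} → v ≈ᵥ v′ → L v → L v′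
      L-resp v≈ p = proj₂ (L≐uw _) (span-resp v≈ (proj₁ (L≐uw _) p))

      L-+ : ∀ {v v′} → L v → L v′ → L (v +ᵥ v′)
      L-+ p q = proj₂ (L≐uw _) (span-+ (proj₁ (L≐uw _) p) (proj₁ (L≐uw _) q))

      L-· : ∀ a {v} → L v → L (a · v)
      L-· a p = proj₂ (L≐uw _) (span-· a (proj₁ (L≐uw _) p))

      coordinates : ∀ {v} → L v → ∃ λ f → Supported 0 3 f × (v ≈ᵥ ⟦ f ⟧)
      coordinates p = span-range→ 0 3 3≤1+M (L⊆Σ₂ _ p)

      z : Vect
      z = proj₁ Lπ-point

      Lπ≐z : (L ∩ πsp x 2) ≐ ⟨ z ⟩
      Lπ≐z = proj₂ (proj₂ Lπ-point)

      z-coordinates : ∃ λ f → Supported 1 2 f × (z ≈ᵥ ⟦ f ⟧)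
      z-coordinates = span-range→ 1 2 3≤1+M (proj₂ (proj₂ (Lπ≐z z) (span-generator (z ∷ []) Fin.zero)))

      fz : Coef
      fz = proj₁ z-coordinates

      fz-support : Supported 1 2 fz
      fz-support = proj₁ (proj₂ z-coordinates)

      z≈ : z ≈ᵥ ⟦ fz ⟧
      z≈ = proj₂ (proj₂ z-coordinates)

      -- z is not a multiple of x₂
      fz₁≉0 : ¬ fz 1 ≈ 0#
      fz₁≉0 fz₁≈0 = Lπ≉x₂ (≐-trans Lπ≐z (≐-trans (point-cong z≈x₂) (point-scale (fz 2) fz₂≉0)))
        where
        on-x₂ : ∀ i → fz i ≈ fz 2 * δ 2 i
        on-x₂ 0 = trans (proj₁ fz-support 0 (s≤s z≤n)) (sym (zeroʳ _))
        on-x₂ 1 = trans fz₁≈0 (sym (zeroʳ _))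
        on-x₂ 2 = sym (*-identityʳ _)
        on-x₂ i@(suc (suc (suc _))) = trans (proj₂ fz-support i (s≤s (s≤s (s≤s z≤n)))) (sym (zeroʳ _))
        z≈x₂ : z ≈ᵥ (fz 2 · x 2)
        z≈x₂ = ≈ᵥ-trans z≈ (≈ᵥ-trans (⟦⟧-cong on-x₂)
                 (≈ᵥ-trans (≈ᵥ-sym (⟦⟧-· (fz 2) (δ 2))) (·-congˡ (fz 2) (⟦δ⟧ 2 2≤M))))
        fz₂≉0 : ¬ fz 2 ≈ 0#
        fz₂≉0 fz₂≈0 = proj₁ (proj₂ Lπ-point) (λ i → trans (z≈x₂ i) (trans (*-congʳ fz₂≈0) (zeroˡ _)))

      ι : Carrier
      ι = fz 1 ⁻¹⟨ fz₁≉0 ⟩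

      t : Carrier
      t = fz 2 * ι

      P : Coef
      P = plane 0# 1# t

      P≈z : ⟦ P ⟧ ≈ᵥ (ι · z)
      P≈z = ≈ᵥ-trans (⟦⟧-cong scaled) (≈ᵥ-trans (≈ᵥ-sym (⟦⟧-· ι fz)) (·-congˡ ι (≈ᵥ-sym z≈)))
        where
        scaled : ∀ i → P i ≈ ι * fz i
        scaled 0 = sym (trans (*-congˡ (proj₁ fz-support 0 (s≤s z≤n))) (zeroʳ ι))
        scaled 1 = sym (*-inverseˡ (fz 1) fz₁≉0)
        scaled 2 = *-comm (fz 2) ι
        scaled i@(suc (suc (suc _))) = sym (trans (*-congˡ (proj₂ fz-support i (s≤s (s≤s (s≤s z≤n))))) (zeroʳ ι))

      Lπ≐P : (L ∩ πsp x 2) ≐ ⟨ ⟦ P ⟧ ⟩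
      Lπ≐P = ≐-trans Lπ≐z (≐-sym (≐-trans (point-cong P≈z) (point-scale ι (inverse-nonzero (fz 1) fz₁≉0))))

      P∈L : L ⟦ P ⟧
      P∈L = proj₁ (proj₂ (Lπ≐P _) (span-generator (⟦ P ⟧ ∷ []) Fin.zero))

      on-π₂ : ∀ {v} f → L v → v ≈ᵥ ⟦ f ⟧ → Supported 0 3 f → f 0 ≈ 0# → ∀ i → f i ≈ f 1 * P i
      on-π₂ {v} f p v≈ (_ , f-top) f₀≈0 = multiple (proj₁ (Lπ≐P v) (p , span-range← 1 2 f 3≤1+M (below , f-top) v≈))
        where
        below : ∀ i → i < 1 → f i ≈ 0#
        below 0 _ = f₀≈0
        below (suc i) (s≤s ())
        multiple : ⟨ ⟦ P ⟧ ⟩ v → ∀ i → f i ≈ f 1 * P i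
        multiple (m ∷ [] , v≈mP) i = trans (f≈mP i) (*-congʳ m≈f₁)
          where
          f≈mP : ∀ i → f i ≈ m * P i
          f≈mP = ⟦⟧-injective-plane 2≤M f (λ i → m * P i) f-top
                   (λ i 3≤i → trans (*-congˡ (plane-top 0# 1# t i 3≤i)) (zeroʳ m))
                   (≈ᵥ-trans (≈ᵥ-sym v≈) (≈ᵥ-trans v≈mP (≈ᵥ-trans (λ i → +-identityʳ _) (⟦⟧-· m P))))
          m≈f₁ : m ≈ f 1
          m≈f₁ = sym (trans (f≈mP 1) (*-identityʳ m))

      u-coordinates : ∃ λ f → Supported 0 3 f × (u ≈ᵥ ⟦ f ⟧)
      u-coordinates = coordinates (proj₂ (L≐uw u) (span-generator (u ∷ w ∷ []) Fin.zero))

      w-coordinates : ∃ λ f → Supported 0 3 f × (w ≈ᵥ ⟦ f ⟧)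
      w-coordinates = coordinates (proj₂ (L≐uw w) (span-generator (u ∷ w ∷ []) (Fin.suc Fin.zero)))

      fu fw : Coef
      fu = proj₁ u-coordinates
      fw = proj₁ w-coordinates

      uw-coordinates : ∀ a b → lincomb (a ∷ b ∷ []) (u ∷ w ∷ []) ≈ᵥ ⟦ (λ i → a * fu i + b * fw i) ⟧
      uw-coordinates a b = ≈ᵥ-trans (+ᵥ-cong (·-congˡ a (proj₂ (proj₂ u-coordinates)))
                                             (≈ᵥ-trans (λ i → +-identityʳ _) (·-congˡ b (proj₂ (proj₂ w-coordinates)))))
                             (≈ᵥ-trans (+ᵥ-cong (⟦⟧-· a fu) (⟦⟧-· b fw)) (⟦⟧-+ (λ i → a * fu i) (λ i → b * fw i)))

      -- the combination of u and w with vanishing x₁-coordinate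
      fq : Coef
      fq i = fw 1 * fu i + (- fu 1) * fw i

      q∈L : L ⟦ fq ⟧
      q∈L = proj₂ (L≐uw _) (span-resp (uw-coordinates (fw 1) (- fu 1)) ((fw 1 ∷ - fu 1 ∷ []) , ≈ᵥ-refl))

      fq-support : Supported 0 3 fq
      fq-support = (λ i ()) , λ i 3≤i →
        trans (+-cong (*-congˡ (proj₂ (proj₁ (proj₂ u-coordinates)) i 3≤i)) (*-congˡ (proj₂ (proj₁ (proj₂ w-coordinates)) i 3≤i)))
          (solve 2 (λ a b → a :* con (0 , 0) :+ b :* con (0 , 0) := con (0 , 0)) refl (fw 1) (- fu 1))

      fq₁≈0 : fq 1 ≈ 0#
      fq₁≈0 = solve 2 (λ a b → b :* a :+ (:- a) :* b := con (0 , 0)) refl (fu 1) (fw 1)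

      -- otherwise q = 0, so u and w would have vanishing x₁-coordinates, and so would P ∈ L
      fq₀≉0 : ¬ fq 0 ≈ 0#
      fq₀≉0 fq₀≈0 = absurd (proj₁ (proj₂ (proj₂ L-line)) (fw 1 ∷ - fu 1 ∷ []) q≈0) (proj₁ (L≐uw _) P∈L)
        where
        fq≈0 : ∀ i → fq i ≈ 0#
        fq≈0 i = trans (on-π₂ fq q∈L ≈ᵥ-refl fq-support fq₀≈0 i) (trans (*-congʳ fq₁≈0) (zeroˡ _))
        q≈0 : lincomb (fw 1 ∷ - fu 1 ∷ []) (u ∷ w ∷ []) ≈ᵥ 0ᵥ
        q≈0 = ≈ᵥ-trans (uw-coordinates (fw 1) (- fu 1)) (≈ᵥ-trans (⟦⟧-cong fq≈0) (≈ᵥ-sym ⟦⟧-0))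
        absurd : All (λ a → a ≈ 0#) (fw 1 ∷ - fu 1 ∷ []) → Span (u ∷ w ∷ []) ⟦ P ⟧ → ⊥
        absurd (fw₁≈0 ∷ -fu₁≈0 ∷ []) (a ∷ b ∷ [] , P≈) = 0≉1 (sym (begin
          1#                    ≈⟨ ⟦⟧-injective P (λ i → a * fu i + b * fw i) (≈ᵥ-trans P≈ (uw-coordinates a b)) 1
                                     (ℕₚ.≤-trans (s≤s z≤n) 2≤M) ⟩
          a * fu 1 + b * fw 1   ≈⟨ +-cong (*-congˡ fu₁≈0) (*-congˡ fw₁≈0) ⟩
          a * 0# + b * 0#       ≈⟨ solve 2 (λ a b → a :* con (0 , 0) :+ b :* con (0 , 0) := con (0 , 0)) refl a b ⟩
          0#                    ∎))
          where
          fu₁≈0 : fu 1 ≈ 0#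
          fu₁≈0 = trans (solve 1 (λ a → a := :- (:- a)) refl (fu 1)) (trans (-‿cong -fu₁≈0) (solve 0 (:- con (0 , 0) := con (0 , 0)) refl))

      ι′ : Carrier
      ι′ = fq 0 ⁻¹⟨ fq₀≉0 ⟩

      r : Carrier
      r = fq 2 * ι′

      Q : Coef
      Q = plane 1# 0# r

      Q∈L : L ⟦ Q ⟧
      Q∈L = L-resp (≈ᵥ-trans (⟦⟧-· ι′ fq) (⟦⟧-cong scaled)) (L-· ι′ q∈L)
        where
        scaled : ∀ i → ι′ * fq i ≈ Q i
        scaled 0 = *-inverseˡ (fq 0) fq₀≉0
        scaled 1 = trans (*-congˡ fq₁≈0) (zeroʳ ι′)
        scaled 2 = *-comm ι′ (fq 2)
        scaled i@(suc (suc (suc _))) = trans (*-congˡ (proj₂ fq-support i (s≤s (s≤s (s≤s z≤n))))) (zeroʳ ι′)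

      L≐PQ : L ≐ ⟪ pair P Q ⟫
      L≐PQ = ⊆-antisym ⊆PQ ⊇PQ
        where
        ⊆PQ : L ⊆ ⟪ pair P Q ⟫
        ⊆PQ v p = decompose (coordinates p)
          where
          decompose : (∃ λ f → Supported 0 3 f × (v ≈ᵥ ⟦ f ⟧)) → ⟪ pair P Q ⟫ v
          decompose (f , (_ , f-top) , v≈) = ⟪⟫← (pair P Q) (g 1 ∷ f 0 ∷ []) (≈ᵥ-trans v≈ (⟦⟧-cong f≈))
            where
              -- removing the x₀-component leaves a multiple of P
              g : Coef
              g i = f i + (- f 0) * Q i
              g∈L : L ⟦ g ⟧
              g∈L = L-resp (≈ᵥ-trans (+ᵥ-cong v≈ (⟦⟧-· (- f 0) Q)) (⟦⟧-+ f (λ i → (- f 0) * Q i))) (L-+ p (L-· (- f 0) Q∈L))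
              g-top : ∀ i → 3 ≤ i → g i ≈ 0#
              g-top i 3≤i = trans (+-cong (f-top i 3≤i) (*-congˡ (plane-top 1# 0# r i 3≤i)))
                              (solve 1 (λ a → con (0 , 0) :+ a :* con (0 , 0) := con (0 , 0)) refl (- f 0))
              g₀≈0 : g 0 ≈ 0#
              g₀≈0 = solve 1 (λ a → a :+ (:- a) :* con (1 , 0) := con (0 , 0)) refl (f 0)
              f≈ : ∀ i → f i ≈ comb (g 1 ∷ f 0 ∷ []) (pair P Q) i
              f≈ i = begin
                f i                           ≈⟨ solve 3 (λ f f₀ q → f := (f :+ (:- f₀) :* q) :+ (f₀ :* q :+ con (0 , 0))) refl (f i) (f 0) (Q i) ⟩
                g i + (f 0 * Q i + 0#)        ≈⟨ +-congʳ (on-π₂ g g∈L ≈ᵥ-refl ((λ i ()) , g-top) g₀≈0 i) ⟩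
                g 1 * P i + (f 0 * Q i + 0#)  ∎
        ⊇PQ : ⟪ pair P Q ⟫ ⊆ L
        ⊇PQ v p = proj₂ (L≐uw v) (span-⊆ (λ { Fin.zero → proj₁ (L≐uw _) P∈L
                                             ; (Fin.suc Fin.zero) → proj₁ (L≐uw _) Q∈L }) v p)

    OnLine : ℕ → Carrier → Vect → Set (c ⊔ ℓ)
    OnLine j κ y = ∃₂ λ α β → ¬ α ≈ 0# × κ * α ≈ β × (y ≈ᵥ ⟦ (λ i → α * δ j i + β * δ (suc j) i) ⟧)

    module Generators {m n : ℕ} (base : Fin n → Fin m → Coef) (κ : ℕ → Carrier)
        (base-top : ∀ u s i → 3 ≤ i → base u s i ≈ 0#)
        (base-agree : ∀ u v s i → i ≢ 2 → base u s i ≈ base v s i) where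

      -- J = (…, b, a) is stored as a ∷ b ∷ R; its generators come from those of
      -- J∖{a} = b ∷ R (paired with x_{3+k}) and J∖{b} = a ∷ R (paired with y_{3+k})
      gens : ∀ {k} → Vec (Fin n) (suc k) → Fin m → Coef
      gens (u ∷ []) = base u
      gens {suc k} (a ∷ b ∷ R) s = step (κ k) (2 ℕ.+ k) (gens (b ∷ R) s) (gens (a ∷ R) s)

      gens-step : ∀ {k} a b (R : Vec (Fin n) k) s i → i ≢ 3 ℕ.+ k → gens (a ∷ b ∷ R) s i ≈ gens (b ∷ R) s i
      gens-step {k} a b R s i i≢ =
        trans (+-congˡ (trans (*-congˡ (reflexive (δ-other (3 ℕ.+ k) i i≢))) (zeroʳ _))) (+-identityʳ _)

      gens-top : ∀ {k} (J : Vec (Fin n) (suc k)) s i → 3 ℕ.+ k ≤ i → gens J s i ≈ 0#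
      gens-top (u ∷ []) s i 3≤i = base-top u s i 3≤i
      gens-top {suc k} (a ∷ b ∷ R) s i 4+k≤i =
        trans (gens-step a b R s i (λ e → ℕₚ.<-irrefl (P.sym e) 4+k≤i)) (gens-top (b ∷ R) s i (ℕₚ.<⇒≤ 4+k≤i))

      gens-agree : ∀ {k} a b (R : Vec (Fin n) k) s i → i ≢ 2 ℕ.+ k → gens (a ∷ R) s i ≈ gens (b ∷ R) s i
      gens-agree a b [] s i i≢2 = base-agree a b s i i≢2
      gens-agree {suc k} a b (c ∷ R) s i i≢ = trans (gens-step a c R s i i≢) (sym (gens-step b c R s i i≢))

      gens-low : ∀ {k} (J : Vec (Fin n) (suc k)) u s i → i < 2 → gens J s i ≈ base u s i
      gens-low (v ∷ []) u s i i<2 = base-agree v u s i (λ e → ℕₚ.<-irrefl e i<2)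
      gens-low {suc k} (a ∷ b ∷ R) u s i i<2 =
        trans (gens-step a b R s i (λ e → ℕₚ.<-irrefl e (ℕₚ.<-≤-trans i<2 (s≤s (s≤s z≤n)))))
              (gens-low (b ∷ R) u s i i<2)

      gens-det : ∀ {m′} (σ : Fin m′ → Fin m) → (∀ u → Determined 2 (λ t → base u (σ t))) →
                 ∀ {k} (J : Vec (Fin n) (suc k)) → Determined 2 (λ t → gens J (σ t))
      gens-det σ base-det J@(u ∷ _) = determined-transfer (λ t i i<2 → sym (gens-low J u (σ t) i i<2)) (base-det u)

      meet-step : ∀ {m′} (σ : Fin m′ → Fin m) → (∀ u → Determined 2 (λ t → base u (σ t))) →
                  ∀ (y : Vect) {k} a b (R : Vec (Fin n) k) → 3 ℕ.+ k ≤ M → OnLine (2 ℕ.+ k) (κ k) y →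
                  ∀ {S T} → S ≐ ⟪ (λ t → gens (b ∷ R) (σ t)) ⟫ → T ≐ ⟪ (λ t → gens (a ∷ R) (σ t)) ⟫ →
                  ((⟨ x (3 ℕ.+ k) ⟩ ⊕ S) ∩ (⟨ y ⟩ ⊕ T)) ≐ ⟪ (λ t → gens (a ∷ b ∷ R) (σ t)) ⟫
      meet-step σ base-det y {k} a b R 3+k≤M (α , β , α≉0 , κα≈β , y≈) S≐ T≐ =
        ≐-trans (∩-cong (⊕-cong ≐-refl S≐) (⊕-cong ≐-refl T≐))
          (Meet.meet (2 ℕ.+ k) 3+k≤M (λ t → gens (b ∷ R) (σ t)) (λ t → gens (a ∷ R) (σ t))
             (λ t → gens-top (b ∷ R) (σ t) (3 ℕ.+ k) ℕₚ.≤-refl) (λ t → gens-top (a ∷ R) (σ t) (3 ℕ.+ k) ℕₚ.≤-refl)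
             (λ t → gens-agree b a R (σ t)) (determined-mono (s≤s (s≤s z≤n)) (gens-det σ base-det (b ∷ R)))
             α β (κ k) α≉0 κα≈β y≈)

      module Distinct (s : Fin m) (κ≉0 : ∀ k → 3 ℕ.+ k ≤ M → ¬ κ k ≈ 0#)
                      (base-distinct : ∀ u v → u ≢ v → ¬ base u s 2 ≈ base v s 2) where

        top : ∀ {k} → Vec (Fin n) (suc k) → Carrier
        top {k} J = gens J s (2 ℕ.+ k)

        top-step : ∀ {k} a b (R : Vec (Fin n) k) → top (a ∷ b ∷ R) ≈ κ k * (top (b ∷ R) - top (a ∷ R))
        top-step {k} a b R =
          trans (+-cong (gens-top (b ∷ R) s (3 ℕ.+ k) ℕₚ.≤-refl) (*-congˡ (reflexive (δ-same (3 ℕ.+ k)))))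
                (trans (+-identityˡ _) (*-identityʳ _))

        top-distinct : ∀ {k} a a′ (R : Vec (Fin n) k) → 2 ℕ.+ k ≤ M → a ≢ a′ → ¬ top (a ∷ R) ≈ top (a′ ∷ R)
        top-distinct a a′ [] _ a≢a′ = base-distinct a a′ a≢a′
        top-distinct {suc k} a a′ (c ∷ R) 3+k≤M a≢a′ eq = top-distinct a a′ R (ℕₚ.<⇒≤ 3+k≤M) a≢a′
          (−-cancelˡ (*-cancelˡ (κ≉0 k 3+k≤M) (trans (sym (top-step a c R)) (trans eq (top-step a′ c R)))))

        top-nonzero : ∀ {k} a b (R : Vec (Fin n) k) → 3 ℕ.+ k ≤ M → a ≢ b → ¬ top (a ∷ b ∷ R) ≈ 0#
        top-nonzero {k} a b R 3+k≤M a≢b top≈0 =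
          top-distinct b a R (ℕₚ.<⇒≤ 3+k≤M) (λ e → a≢b (P.sym e))
            (difference-zero (zero-product (κ≉0 k 3+k≤M) (trans (sym (top-step a b R)) top≈0)))

        Agree : ∀ {k k′} → Vec (Fin n) (suc k) → Vec (Fin n) (suc k′) → Set ℓ
        Agree J J′ = ∀ i → i ≤ M → gens J s i ≈ gens J′ s i

        same-length : ∀ {k} (J J′ : Vec (Fin n) (suc k)) → 2 ℕ.+ k ≤ M → J ≢ J′ → ¬ Agree J J′
        same-length (u ∷ []) (v ∷ []) 2≤M J≢J′ agree =
          base-distinct u v (λ e → J≢J′ (P.cong (_∷ []) e)) (agree 2 2≤M)
        same-length {suc k} (a ∷ b ∷ R) (a′ ∷ b′ ∷ R′) 3+k≤M J≢J′ agree
          with Vecₚ.≡-dec Fin._≟_ (b ∷ R) (b′ ∷ R′)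
        ... | yes P.refl = top-distinct a a′ R (ℕₚ.<⇒≤ 3+k≤M) (λ e → J≢J′ (P.cong (λ a → a ∷ b ∷ R) e))
                 (−-cancelˡ (*-cancelˡ (κ≉0 k 3+k≤M)
                   (trans (sym (top-step a b R)) (trans (agree (3 ℕ.+ k) 3+k≤M) (top-step a′ b R)))))
        ... | no tails≢ = same-length (b ∷ R) (b′ ∷ R′) (ℕₚ.<⇒≤ 3+k≤M) tails≢ tails-agree
          where
          tails-agree : Agree (b ∷ R) (b′ ∷ R′)
          tails-agree i i≤M with i ℕ.≟ 3 ℕ.+ k
          ... | yes P.refl = trans (gens-top (b ∷ R) s i ℕₚ.≤-refl) (sym (gens-top (b′ ∷ R′) s i ℕₚ.≤-refl))
          ... | no i≢ = trans (sym (gens-step a b R s i i≢)) (trans (agree i i≤M) (gens-step a′ b′ R′ s i i≢))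

        -- a longer sequence has a nonzero top coordinate where the shorter one vanishes
        shorter : ∀ {k k′} (J : Vec (Fin n) (suc k)) (J′ : Vec (Fin n) (suc k′)) → k < k′ → 2 ℕ.+ k′ ≤ M →
                  Unique (toList J′) → ¬ Agree J J′
        shorter {k} {suc k′} J (a′ ∷ b′ ∷ R′) (s≤s k≤k′) 3+k′≤M ((a′≢b′ ∷ _) ∷ _) agree =
          top-nonzero a′ b′ R′ 3+k′≤M a′≢b′
            (trans (sym (agree (3 ℕ.+ k′) 3+k′≤M)) (gens-top J s (3 ℕ.+ k′) (ℕₚ.+-monoʳ-≤ 3 k≤k′)))

        distinct : ∀ {k k′} (J : Vec (Fin n) (suc k)) (J′ : Vec (Fin n) (suc k′)) →
                   2 ℕ.+ k ≤ M → 2 ℕ.+ k′ ≤ M → Unique (toList J) → Unique (toList J′) →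
                   toList J ≢ toList J′ → ¬ Agree J J′
        distinct {k} {k′} J J′ le le′ uJ uJ′ J≢J′ with ℕₚ.<-cmp k k′
        ... | tri< k<k′ _ _ = shorter J J′ k<k′ le′ uJ′
        ... | tri> _ _ k′<k = λ agree → shorter J′ J k′<k le uJ (λ i i≤M → sym (agree i i≤M))
        ... | tri≈ _ P.refl _ = same-length J J′ le (λ e → J≢J′ (P.cong toList e))


module Lemma {c ℓ} (F : Field c ℓ) (M : ℕ) (2≤M : 2 ≤ M) (x : ℕ → PG.Vect F M)
    (indep : PG.LinIndep F M (PG.range F M x 0 (suc M))) (y : ℕ → PG.Vect F M)
    (hy : ∀ i → 2 ≤ i → suc i ≤ M →
      ¬ (PG._≈ᵥ_ F M (y (suc i)) (PG.0ᵥ F M))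
      × PG._⊆_ F M (PG.⟨_⟩ F M (y (suc i))) (PG.Span F M (x i ∷ x (suc i) ∷ []))
      × ¬ (PG._≐_ F M (PG.⟨_⟩ F M (y (suc i))) (PG.⟨_⟩ F M (x i)))
      × ¬ (PG._≐_ F M (PG.⟨_⟩ F M (y (suc i))) (PG.⟨_⟩ F M (x (suc i)))))
    (n : ℕ) (lines : Fin n → PG.Subspace F M)
    (hl : ∀ i → PG.IsLine F M (lines i)
      × PG._⊆_ F M (lines i) (PG.Σsp F M x 2)
      × ¬ (PG._≐_ F M (lines i) (PG.πsp F M x 2))
      × PG.IsPoint F M (PG._∩_ F M (lines i) (PG.πsp F M x 2))
      × ¬ (PG._≐_ F M (PG._∩_ F M (lines i) (PG.πsp F M x 2)) (PG.⟨_⟩ F M (x 2))))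
    (hd : ∀ i j → i ≢ j →
      ¬ (PG._≐_ F M (PG._∩_ F M (lines i) (PG.πsp F M x 2)) (PG._∩_ F M (lines j) (PG.πsp F M x 2))))
    where
  open Field F
  open PG F M
  open PG.Construction F M x y lines
  open IntegerCoefficientSolver commutativeRing using (solve; _:=_; _:+_; _:*_; con)
  open FieldFacts F
  open Spans F M
  open Coordinates F M x
  open Independent indep
  open import Relation.Binary.Reasoning.Setoid setoid

  module NF (u : Fin n) = NormalForm 2≤M (lines u) (proj₁ (hl u)) (proj₁ (proj₂ (hl u)))
                                     (proj₁ (proj₂ (proj₂ (proj₂ (hl u))))) (proj₂ (proj₂ (proj₂ (proj₂ (hl u)))))

  base : Fin n → Fin 2 → Coef
  base u = pair (NF.P u) (NF.Q u)

  base-top : ∀ u s i → 3 ≤ i → base u s i ≈ 0#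
  base-top u Fin.zero = plane-top 0# 1# (NF.t u)
  base-top u (Fin.suc Fin.zero) = plane-top 1# 0# (NF.r u)

  base-agree : ∀ u v s i → i ≢ 2 → base u s i ≈ base v s i
  base-agree u v Fin.zero = plane-agree 0# 1# (NF.t u) (NF.t v)
  base-agree u v (Fin.suc Fin.zero) = plane-agree 1# 0# (NF.r u) (NF.r v)

  line-determined : ∀ u → Determined 2 (λ s → base u s)
  line-determined u (a ∷ b ∷ []) (a′ ∷ b′ ∷ []) agree Fin.zero = begin
    a                              ≈⟨ solve 2 (λ a b → a := a :* con (1 , 0) :+ (b :* con (0 , 0) :+ con (0 , 0))) refl a b ⟩
    a * 1# + (b * 0# + 0#)         ≈⟨ agree 1 (s≤s (s≤s z≤n)) ⟩
    a′ * 1# + (b′ * 0# + 0#)       ≈⟨ solve 2 (λ a b → a :* con (1 , 0) :+ (b :* con (0 , 0) :+ con (0 , 0)) := a) refl a′ b′ ⟩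
    a′                             ∎
  line-determined u (a ∷ b ∷ []) (a′ ∷ b′ ∷ []) agree (Fin.suc Fin.zero) = begin
    b                              ≈⟨ solve 2 (λ a b → b := a :* con (0 , 0) :+ (b :* con (1 , 0) :+ con (0 , 0))) refl a b ⟩
    a * 0# + (b * 1# + 0#)         ≈⟨ agree 0 (s≤s z≤n) ⟩
    a′ * 0# + (b′ * 1# + 0#)       ≈⟨ solve 2 (λ a b → a :* con (0 , 0) :+ (b :* con (1 , 0) :+ con (0 , 0)) := b) refl a′ b′ ⟩
    b′                             ∎

  point-determined : ∀ u → Determined {1} 2 (λ _ → base u Fin.zero)
  point-determined u (a ∷ []) (a′ ∷ []) agree Fin.zero =
    trans (sym (trans (+-identityʳ _) (*-identityʳ a))) (trans (agree 1 (s≤s (s≤s z≤n))) (trans (+-identityʳ _) (*-identityʳ a′)))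

  -- distinct lines meet π₂ in distinct points, so their parameters t differ
  t-distinct : ∀ u v → u ≢ v → ¬ base u Fin.zero 2 ≈ base v Fin.zero 2
  t-distinct u v u≢v t≈ = hd u v u≢v
    (≐-trans (NF.Lπ≐P u) (≐-trans (point-cong (⟦⟧-cong (plane-cong 0# 1# t≈))) (≐-sym (NF.Lπ≐P v))))

  YCoordinates : ℕ → Set (c ⊔ ℓ)
  YCoordinates k = ∃₂ λ α β → ¬ α ≈ 0# × ¬ β ≈ 0# ×
                   (y (3 ℕ.+ k) ≈ᵥ ⟦ (λ i → α * δ (2 ℕ.+ k) i + β * δ (3 ℕ.+ k) i) ⟧)

  y-coordinates : ∀ k → 3 ℕ.+ k ≤ M → YCoordinates k
  y-coordinates k 3+k≤M = from-hypotheses (hy (2 ℕ.+ k) (s≤s (s≤s z≤n)) 3+k≤M)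
    where
    from-hypotheses : ¬ y (3 ℕ.+ k) ≈ᵥ 0ᵥ × ⟨ y (3 ℕ.+ k) ⟩ ⊆ Span (x (2 ℕ.+ k) ∷ x (3 ℕ.+ k) ∷ [])
                      × ¬ (⟨ y (3 ℕ.+ k) ⟩ ≐ ⟨ x (2 ℕ.+ k) ⟩) × ¬ (⟨ y (3 ℕ.+ k) ⟩ ≐ ⟨ x (3 ℕ.+ k) ⟩) →
                      YCoordinates k
    from-hypotheses (y≉0 , y∈ , y≉x₂₊ₖ , y≉x₃₊ₖ) = from-span (y∈ _ (span-generator (y (3 ℕ.+ k) ∷ []) Fin.zero))
      where
      from-span : Span (x (2 ℕ.+ k) ∷ x (3 ℕ.+ k) ∷ []) (y (3 ℕ.+ k)) → YCoordinates k
      from-span (α ∷ β ∷ [] , y≈) = α , β , α≉0 , β≉0 ,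
        ≈ᵥ-trans y≈ (≈ᵥ-trans (+ᵥ-cong (·-congˡ α (≈ᵥ-sym (⟦δ⟧ (2 ℕ.+ k) (ℕₚ.<⇒≤ 3+k≤M))))
                                         (≈ᵥ-trans (λ i → +-identityʳ _) (·-congˡ β (≈ᵥ-sym (⟦δ⟧ (3 ℕ.+ k) 3+k≤M)))))
                               (≈ᵥ-trans (+ᵥ-cong (⟦⟧-· α (δ (2 ℕ.+ k))) (⟦⟧-· β (δ (3 ℕ.+ k))))
                                         (⟦⟧-+ (λ i → α * δ (2 ℕ.+ k) i) (λ i → β * δ (3 ℕ.+ k) i))))
        where
        -- if one coefficient vanished, y would be a multiple of one of the two points
        y≈βx : α ≈ 0# → y (3 ℕ.+ k) ≈ᵥ (β · x (3 ℕ.+ k))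
        y≈βx α≈0 i = trans (y≈ i) (trans (+-congʳ (trans (*-congʳ α≈0) (zeroˡ _))) (trans (+-identityˡ _) (+-identityʳ _)))
        y≈αx : β ≈ 0# → y (3 ℕ.+ k) ≈ᵥ (α · x (2 ℕ.+ k))
        y≈αx β≈0 i = trans (y≈ i) (trans (+-congˡ (trans (+-identityʳ _) (trans (*-congʳ β≈0) (zeroˡ _)))) (+-identityʳ _))
        α≉0 : ¬ α ≈ 0#
        α≉0 α≈0 = y≉x₃₊ₖ (≐-trans (point-cong (y≈βx α≈0)) (point-scale β β≉0′))
          where
          β≉0′ : ¬ β ≈ 0#
          β≉0′ β≈0 = y≉0 (λ i → trans (y≈βx α≈0 i) (trans (*-congʳ β≈0) (zeroˡ _)))
        β≉0 : ¬ β ≈ 0#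
        β≉0 β≈0 = y≉x₂₊ₖ (≐-trans (point-cong (y≈αx β≈0)) (point-scale α α≉0′))
          where
          α≉0′ : ¬ α ≈ 0#
          α≉0′ α≈0 = y≉0 (λ i → trans (y≈αx β≈0 i) (trans (*-congʳ α≈0) (zeroˡ _)))

  slope : ∀ {k} → YCoordinates k → Carrier
  slope (α , β , α≉0 , _) = β * α ⁻¹⟨ α≉0 ⟩

  -- the slopes κ k = β/α of the points y_{3+k} (irrelevant where y_{3+k} is not given)
  κ : ℕ → Carrier
  κ k with 3 ℕ.+ k ℕ.≤? M
  ... | yes 3+k≤M = slope (y-coordinates k 3+k≤M)
  ... | no _ = 0#

  κ-spec : ∀ k (3+k≤M : 3 ℕ.+ k ≤ M) → κ k ≡ slope (y-coordinates k 3+k≤M)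
  κ-spec k 3+k≤M with 3 ℕ.+ k ℕ.≤? M
  ... | yes le = P.cong (λ le → slope (y-coordinates k le)) (ℕₚ.≤-irrelevant le 3+k≤M)
  ... | no 3+k≰M = ⊥-elim (3+k≰M 3+k≤M)

  y-on-line : ∀ k (3+k≤M : 3 ℕ.+ k ≤ M) → OnLine (2 ℕ.+ k) (κ k) (y (3 ℕ.+ k))
  y-on-line k 3+k≤M = P.subst (λ κ → OnLine (2 ℕ.+ k) κ (y (3 ℕ.+ k))) (P.sym (κ-spec k 3+k≤M))
                              (on-line (y-coordinates k 3+k≤M))
    where
    on-line : (Y : YCoordinates k) → OnLine (2 ℕ.+ k) (slope Y) (y (3 ℕ.+ k))
    on-line (α , β , α≉0 , _ , y≈) =
      α , β , α≉0 , trans (*-assoc β _ α) (trans (*-congˡ (*-inverseˡ α α≉0)) (*-identityʳ β)) , y≈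

  κ≉0 : ∀ k → 3 ℕ.+ k ≤ M → ¬ κ k ≈ 0#
  κ≉0 k 3+k≤M = P.subst (λ κ → ¬ κ ≈ 0#) (P.sym (κ-spec k 3+k≤M)) (slope≉0 (y-coordinates k 3+k≤M))
    where
    slope≉0 : (Y : YCoordinates k) → ¬ slope Y ≈ 0#
    slope≉0 (α , β , α≉0 , β≉0 , _) = nonzero-product β≉0 (inverse-nonzero α α≉0)

  open Generators base κ base-top base-agree

  both : Fin 2 → Fin 2
  both s = s

  first : Fin 1 → Fin 2
  first _ = Fin.zero
  open Distinct Fin.zero κ≉0 t-distinct

  ℓ-span : ∀ {k} (J : Vec (Fin n) (suc k)) → 2 ℕ.+ k ≤ M → ℓJ J ≐ ⟪ gens J ⟫
  ℓ-span (u ∷ []) _ = NF.L≐PQ u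
  ℓ-span {suc k} (a ∷ b ∷ R) 3+k≤M =
    meet-step both line-determined (y (3 ℕ.+ k)) a b R 3+k≤M (y-on-line k 3+k≤M)
      (ℓ-span (b ∷ R) (ℕₚ.<⇒≤ 3+k≤M)) (ℓ-span (a ∷ R) (ℕₚ.<⇒≤ 3+k≤M))

  p-span : ∀ {k} (J : Vec (Fin n) (suc k)) → 2 ℕ.+ k ≤ M → pJ J ≐ ⟨ ⟦ gens J Fin.zero ⟧ ⟩
  p-span (u ∷ []) _ = NF.Lπ≐P u
  p-span {suc k} (a ∷ b ∷ R) 3+k≤M =
    meet-step first point-determined (y (3 ℕ.+ k)) a b R 3+k≤M (y-on-line k 3+k≤M)
      (p-span (b ∷ R) (ℕₚ.<⇒≤ 3+k≤M)) (p-span (a ∷ R) (ℕₚ.<⇒≤ 3+k≤M))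

  2≤1+M : 2 ≤ suc M
  2≤1+M = ℕₚ.m≤n⇒m≤1+n 2≤M

  module _ {k} (J : Vec (Fin n) (suc k)) (2+k≤M : 2 ℕ.+ k ≤ M) where

    is-line : IsLine (ℓJ J)
    is-line = _ , _ , determined-independent 2≤1+M (gens-det both line-determined J) , ℓ-span J 2+k≤M

    is-point : IsPoint (pJ J)
    is-point = _ , independent-nonzero (determined-independent 2≤1+M (gens-det first point-determined J))
                 , p-span J 2+k≤M

    ℓ-meets-π : (ℓJ J ∩ πsp x (2 ℕ.+ k)) ≐ pJ J
    ℓ-meets-π = ≐-trans (∩-cong (ℓ-span J 2+k≤M) ≐-refl)
      (≐-trans (line-meets-π (2 ℕ.+ k) 2+k≤M (gens J Fin.zero) (gens J (Fin.suc Fin.zero))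
                  (gens-low J (Vec.head J) Fin.zero 0 (s≤s z≤n))
                  (λ Q₀≈0 → 0≉1 (trans (sym Q₀≈0) (gens-low J (Vec.head J) (Fin.suc Fin.zero) 0 (s≤s z≤n))))
                  (gens-top J Fin.zero))
               (≐-sym (p-span J 2+k≤M)))

  module _ {k k′} (J : Vec (Fin n) (suc k)) (J′ : Vec (Fin n) (suc k′))
           (2+k≤M : 2 ℕ.+ k ≤ M) (2+k′≤M : 2 ℕ.+ k′ ≤ M) where

    low-agree : ∀ s i → i < 2 → gens J s i ≈ gens J′ s i
    low-agree s i i<2 = trans (gens-low J (Vec.head J) s i i<2) (sym (gens-low J′ (Vec.head J) s i i<2))

    equal-lines : ℓJ J ≐ ℓJ J′ → Agree J J′
    equal-lines ℓ≐ℓ′ = generators-unique 2≤1+M (gens-det both line-determined J′) low-agree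
      (λ v p → proj₁ (ℓ-span J′ 2+k′≤M v) (proj₁ (ℓ≐ℓ′ v) (proj₂ (ℓ-span J 2+k≤M v) p))) Fin.zero

    equal-points : pJ J ≐ pJ J′ → Agree J J′
    equal-points p≐p′ = generators-unique 2≤1+M (gens-det first point-determined J′)
      (λ _ → low-agree Fin.zero)
      (λ v p → proj₁ (p-span J′ 2+k′≤M v) (proj₁ (p≐p′ v) (proj₂ (p-span J 2+k≤M v) p))) Fin.zero

  -- the admissible lengths:  |J| ≤ M - 1  means  2 + k ≤ M
  length-bound : ∀ {k} → suc k ≤ M ∸ 1 → 2 ℕ.+ k ≤ M
  length-bound {k} = go M
    where
    go : ∀ M → suc k ≤ M ∸ 1 → 2 ℕ.+ k ≤ M
    go (suc M) le = s≤s le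

  result : ∀ k (J : Vec (Fin n) (suc k)) → suc k ≤ M ∸ 1 → Unique (toList J) →
    IsLine (ℓJ J) × IsPoint (pJ J)
    × (∀ k′ (J′ : Vec (Fin n) (suc k′)) → suc k′ ≤ M ∸ 1 → Unique (toList J′) → toList J ≢ toList J′ →
        ¬ (ℓJ J ≐ ℓJ J′) × ¬ (pJ J ≐ pJ J′))
    × ((ℓJ J ∩ πsp x (suc (suc k))) ≐ pJ J)
  result k J le uJ =
    is-line J (length-bound le) , is-point J (length-bound le) ,
    (λ k′ J′ le′ uJ′ J≢J′ →
        (λ ℓ≐ℓ′ → distinct J J′ (length-bound le) (length-bound le′) uJ uJ′ J≢J′
                    (equal-lines J J′ (length-bound le) (length-bound le′) ℓ≐ℓ′))
      , (λ p≐p′ → distinct J J′ (length-bound le) (length-bound le′) uJ uJ′ J≢J′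
                    (equal-points J J′ (length-bound le) (length-bound le′) p≐p′))) ,
    ℓ-meets-π J (length-bound le)

lemma2p1 : ∀ {c ℓ} (F : Field c ℓ) (M : ℕ) → 2 ≤ M →
  (x : ℕ → PG.Vect F M) →
  PG.LinIndep F M (PG.range F M x 0 (suc M)) →
  (y : ℕ → PG.Vect F M) →
  (∀ i → 2 ≤ i → suc i ≤ M →
    ¬ (PG._≈ᵥ_ F M (y (suc i)) (PG.0ᵥ F M))
    × PG._⊆_ F M (PG.⟨_⟩ F M (y (suc i))) (PG.Span F M (x i ∷ x (suc i) ∷ []))
    × ¬ (PG._≐_ F M (PG.⟨_⟩ F M (y (suc i))) (PG.⟨_⟩ F M (x i)))
    × ¬ (PG._≐_ F M (PG.⟨_⟩ F M (y (suc i))) (PG.⟨_⟩ F M (x (suc i))))) →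
  (n : ℕ) (lines : Fin n → PG.Subspace F M) →
  (∀ i → PG.IsLine F M (lines i)
    × PG._⊆_ F M (lines i) (PG.Σsp F M x 2)
    × ¬ (PG._≐_ F M (lines i) (PG.πsp F M x 2))
    × PG.IsPoint F M (PG._∩_ F M (lines i) (PG.πsp F M x 2))
    × ¬ (PG._≐_ F M (PG._∩_ F M (lines i) (PG.πsp F M x 2)) (PG.⟨_⟩ F M (x 2)))) →
  (∀ i j → i ≢ j →
    ¬ (PG._≐_ F M (PG._∩_ F M (lines i) (PG.πsp F M x 2)) (PG._∩_ F M (lines j) (PG.πsp F M x 2)))) →
  ∀ k (J : Vec (Fin n) (suc k)) → suc k ≤ M ∸ 1 → Unique (toList J) →
    PG.IsLine F M (PG.Construction.ℓJ F M x y lines J)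
    × PG.IsPoint F M (PG.Construction.pJ F M x y lines J)
    × (∀ k′ (J′ : Vec (Fin n) (suc k′)) → suc k′ ≤ M ∸ 1 → Unique (toList J′) →
        toList J ≢ toList J′ →
        ¬ (PG._≐_ F M (PG.Construction.ℓJ F M x y lines J) (PG.Construction.ℓJ F M x y lines J′))
        × ¬ (PG._≐_ F M (PG.Construction.pJ F M x y lines J) (PG.Construction.pJ F M x y lines J′)))
    × PG._≐_ F M (PG._∩_ F M (PG.Construction.ℓJ F M x y lines J) (PG.πsp F M x (suc (suc k))))
        (PG.Construction.pJ F M x y lines J)
lemma2p1 F M 2≤M x indep y hy n lines hl hd = Lemma.result F M 2≤M x indep y hy n lines hl hd
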